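{- Let $m\ge n\ge 2$, $S'\in RB_U(n)$ and $T\in RB_U(m)$, and write $\pi_n(p_T)(S')=\sum_{S\in O(S')}\pi_n(p_T)(S)$. Then $\pi_n(p_T)(S')$ equals the induced subtree density of $S'$ in $T$, i.e. the number of $n$-element subsets $A$ of the leaves of $T$ such that $T|_A$ has shape $S'$, divided by $\binom{m}{n}$.
   Context: For $k\ge 2$, $RB_L(k)$ denotes the set of rooted binary trees (every non-leaf vertex has exactly two unordered children) with $k$ leaves labelled bijectively by $[k]$, up to label-preserving isomorphism, and $RB_U(k)$ the set of unlabelled tree shapes with $k$ leaves; for $T\in RB_U(k)$, $O(T)$ is the set of labelled trees in $RB_L(k)$ of shape $T$ and $p_T$ is the distribution on $RB_L(k)$ uniform on $O(T)$ and zero elsewhere. For a rooted binary tree $Q$ and a set $A$ of its leaves, $Q|_A$ is the restriction tree: vertices are the elements of $A$ and the lowest common ancestors of pairs of elements of $A$, with ancestry inherited from $Q$. For a distribution $p_m$ on $RB_L(m)$, $\pi_n(p_m)(S)=\sum_{\{Q\in RB_L(m): Q|_{[n]}=S\}}p_m(Q)$ for $S\in RB_L(n)$. -}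

module Defs where

open import Data.Bool using (Bool; true; false; if_then_else_; _∧_; _∨_; T?)
open import Data.Nat using (ℕ; zero; suc; _∸_; _<?_)
open import Data.Nat.Combinatorics using (_C_)
open import Data.Fin using (Fin; toℕ; fromℕ<; _≟_)
open import Data.List using (List; []; _∷_; [_]; map; concatMap; length; filter; foldr; upTo; deduplicateᵇ; allFin; mapMaybe)
open import Data.Maybe using (Maybe; just; nothing)
open import Data.Product using (_×_; _,_; proj₁)
open import Data.Unit using (⊤; tt)
open import Data.Integer using (+_)
open import Data.Rational using (ℚ; 0ℚ; _/_; _+_; _*_)
open import Relation.Nullary.Decidable using (⌊_⌋; yes; no)

-- Planar (ordered) rooted binary trees with leaves labelled in A.
-- A rooted binary tree with unordered children is such a planar tree
-- taken up to swapping the two children of any internal vertex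
-- (label-preserving isomorphism, `iso` below).

data Tree (A : Set) : Set where
  leaf : A → Tree A
  node : Tree A → Tree A → Tree A

mapT : {A B : Set} → (A → B) → Tree A → Tree B
mapT f (leaf a)   = leaf (f a)
mapT f (node l r) = node (mapT f l) (mapT f r)

leafCount : {A : Set} → Tree A → ℕ
leafCount (leaf _)   = 1
leafCount (node l r) = leafCount l Data.Nat.+ leafCount r

iso : {A : Set} → (A → A → Bool) → Tree A → Tree A → Bool
iso eq (leaf a)   (leaf b)     = eq a b
iso eq (leaf _)   (node _ _)   = false
iso eq (node _ _) (leaf _)     = false
iso eq (node l r) (node l′ r′) =
  (iso eq l l′ ∧ iso eq r r′) ∨ (iso eq l r′ ∧ iso eq r l′)

-- Unlabelled shapes: trees with leaves labelled by ⊤, up to isomorphism.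
Shape : Set
Shape = Tree ⊤

shape : {A : Set} → Tree A → Shape
shape = mapT (λ _ → tt)

_≅ₛ_ : Shape → Shape → Bool
_≅ₛ_ = iso (λ _ _ → true)

_≅ₗ_ : {k : ℕ} → Tree (Fin k) → Tree (Fin k) → Bool
_≅ₗ_ = iso (λ i j → ⌊ i ≟ j ⌋)

-- all planar shapes with exactly k leaves (first argument is fuel ≥ k)
shapesF : ℕ → ℕ → List Shape
shapesF zero    k = []
shapesF (suc f) zero = []
shapesF (suc f) (suc zero) = [ leaf tt ]
shapesF (suc f) (suc (suc k)) =
  concatMap (λ i → concatMap (λ l → map (node l) (shapesF f (suc (suc k) ∸ suc i)))
                              (shapesF f (suc i)))
            (upTo (suc k))

planarShapes : ℕ → List Shape
planarShapes k = shapesF k k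

insertAll : {A : Set} → A → List A → List (List A)
insertAll x []       = [ x ∷ [] ]
insertAll x (y ∷ ys) = (x ∷ y ∷ ys) ∷ map (y ∷_) (insertAll x ys)

perms : {A : Set} → List A → List (List A)
perms []       = [ [] ]
perms (x ∷ xs) = concatMap (insertAll x) (perms xs)

fill : {A : Set} → Shape → List A → Maybe (Tree A × List A)
fill (leaf _) []       = nothing
fill (leaf _) (a ∷ as) = just (leaf a , as)
fill (node l r) as with fill l as
... | nothing = nothing
... | just (l′ , as′) with fill r as′
...   | nothing = nothing
...   | just (r′ , as″) = just (node l′ r′ , as″)

fillAll : {A : Set} → Shape → List A → Maybe (Tree A)
fillAll s as with fill s as
... | just (t , []) = just t
... | _ = nothing

planarLabelled : (k : ℕ) → List (Tree (Fin k))
planarLabelled k =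
  concatMap (λ s → mapMaybe (fillAll s) (perms (allFin k))) (planarShapes k)

-- RB_L(k): one representative of each isomorphism class of
-- rooted binary trees with k leaves labelled bijectively by [k] = Fin k
RBL : (k : ℕ) → List (Tree (Fin k))
RBL k = deduplicateᵇ _≅ₗ_ (planarLabelled k)

O : (k : ℕ) → Shape → List (Tree (Fin k))
O k T = filter (λ Q → T? (shape Q ≅ₛ T)) (RBL k)

sumℚ : List ℚ → ℚ
sumℚ = foldr _+_ 0ℚ

-- 1/k for k ≥ 1 (the value at 0 is never used)
invℕ : ℕ → ℚ
invℕ zero    = 0ℚ
invℕ (suc k) = + 1 / suc k

ℕtoℚ : ℕ → ℚ
ℕtoℚ k = + k / 1

-- Restriction Q|_A: keep the leaves selected (and relabelled) by f,
-- suppress vertices with a single remaining child; the result has as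
-- vertices the chosen leaves and the lca's of pairs of them.

restrict : {A B : Set} → (A → Maybe B) → Tree A → Maybe (Tree B)
restrict f (leaf a) with f a
... | just b  = just (leaf b)
... | nothing = nothing
restrict f (node l r) with restrict f l | restrict f r
... | just l′  | just r′  = just (node l′ r′)
... | just l′  | nothing  = just l′
... | nothing  | just r′  = just r′
... | nothing  | nothing  = nothing

toFirst : (m n : ℕ) → Fin m → Maybe (Fin n)
toFirst m n i with toℕ i <? n
... | yes p = just (fromℕ< p)
... | no _  = nothing

restrictTo : (m n : ℕ) → Tree (Fin m) → Maybe (Tree (Fin n))
restrictTo m n = restrict (toFirst m n)

-- Distributions on RB_L(k) are functions Tree (Fin k) → ℚ (evaluated on
-- the representatives RBL k).

p : (m : ℕ) → Shape → Tree (Fin m) → ℚ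
p m T Q = if shape Q ≅ₛ T then invℕ (length (O m T)) else 0ℚ

matches : {n : ℕ} → Maybe (Tree (Fin n)) → Tree (Fin n) → Bool
matches (just Q′) S = Q′ ≅ₗ S
matches nothing   S = false

π : (n m : ℕ) → (Tree (Fin m) → ℚ) → Tree (Fin n) → ℚ
π n m pm S = sumℚ (map pm (filter (λ Q → T? (matches (restrictTo m n Q) S)) (RBL m)))

πShape : (n m : ℕ) → (Tree (Fin m) → ℚ) → Shape → ℚ
πShape n m pm S′ = sumℚ (map (π n m pm) (O n S′))

-- Induced subtree density.  The leaves of a shape T are indexed
-- 0,1,…,leafCount T - 1 from left to right; a subset of the leaves is a
-- characteristic list of booleans of length leafCount T.

number : {A : Set} → Tree A → ℕ → Tree ℕ × ℕ
number (leaf _) i = leaf i , suc i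
number (node l r) i with number l i
... | l′ , j with number r j
...   | r′ , k = node l′ r′ , k

subsetsOf : ℕ → List (List Bool)
subsetsOf zero    = [ [] ]
subsetsOf (suc k) = concatMap (λ s → (true ∷ s) ∷ (false ∷ s) ∷ []) (subsetsOf k)

card : List Bool → ℕ
card []           = 0
card (true ∷ s)   = suc (card s)
card (false ∷ s)  = card s

member : List Bool → ℕ → Bool
member []      _       = false
member (b ∷ s) zero    = b
member (b ∷ s) (suc j) = member s j

select : List Bool → ℕ → Maybe ⊤
select A j = if member A j then just tt else nothing

restrictHasShape : Shape → List Bool → Shape → Bool
restrictHasShape T A S′ with restrict (select A) (proj₁ (number T 0))
... | just R  = R ≅ₛ S′
... | nothing = false

inducedCount : (n : ℕ) → Shape → Shape → ℕ
inducedCount n S′ T =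
  length (filter (λ A → T? (restrictHasShape T A S′))
        (filter (λ A → T? (card A Data.Nat.≡ᵇ n)) (subsetsOf (leafCount T))))

density : (m n : ℕ) → Shape → Shape → ℚ
density m n S′ T = ℕtoℚ (inducedCount n S′ T) * invℕ (m C n)

-- Write N for the number of Q ∈ O(T) whose restriction to the labels [n] has
-- shape S′, and I for the number of n-subsets of leaves of T inducing S′.
-- Summing π_n(p_T) over the representatives of shape S′ gives N / |O(T)|,
-- since a bijectively labelled restriction is isomorphic to exactly one
-- representative.  Now count the pairs (A , Q) of an n-subset A of [m] and a
-- Q ∈ O(T) with Q|_A of shape S′ in two ways.  For fixed A, relabelling by a
-- permutation carrying [n] onto A permutes O(T), so there are N such Q.  For
-- fixed Q, relabelling by the listing of its leaves from left to right
-- identifies Q with T, so there are I such A.  Hence C(m, n) · N = |O(T)| · I.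

module Submission where

open import Defs

open import Axiom.UniquenessOfIdentityProofs.WithK using (uip)
open import Data.Bool using (Bool; true; false; if_then_else_; _∧_; _∨_; T; T?)
open import Data.Bool.Properties using (T-∧; T-∨; T-≡)
open import Data.Empty using (⊥-elim)
open import Data.Fin using (Fin; _≟_; toℕ; fromℕ<; inject≤; zero)
open import Data.Fin.Properties using (toℕ-injective; toℕ-fromℕ<; toℕ-inject≤; toℕ<n; fromℕ<-toℕ)
import Data.Integer as ℤ
import Data.Integer.Properties as ℤ
open import Data.List
  using (List; []; _∷_; _++_; [_]; length; filter; map; mapMaybe; concatMap; allFin; upTo; applyUpTo;
         tabulate; deduplicateᵇ; cartesianProductWith)
open import Data.List.Properties
  using (length-++; length-map; length-tabulate; length-upTo; map-++; map-cong; map-∘; map-id; map-upTo;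
         map-tabulate; mapMaybe-++; ++-identityʳ; ++-assoc; ∷-injective; partition-defn)
open import Data.List.Membership.Propositional using (_∈_; find; lose)
open import Data.List.Membership.Propositional.Properties
  using (∈-∃++; ∈-filter⁻; ∈-filter⁺; ∈-concatMap⁺; ∈-concatMap⁻; ∈-map⁺; ∈-map⁻; ∈-upTo⁺; ∈-upTo⁻;
         ∈-deduplicate⁻; ∈-allFin; ∈-length)
open import Data.List.Membership.Setoid.Properties using (unique⇒irrelevant)
open import Data.List.Relation.Binary.BagAndSetEquality using (∼bag⇒↭)
open import Data.List.Relation.Binary.Permutation.Propositional
  using (_↭_; ↭-refl; ↭-sym; ↭-trans; prep; swap; ↭⇒↭ₛ; ↭ₛ⇒↭)
import Data.List.Relation.Binary.Permutation.Propositional.Properties as ↭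
open import Data.List.Relation.Binary.Permutation.Propositional.Properties
  using (++⁺; ++-comm; ∈-resp-↭; ↭-length; ↭-empty-inv; drop-mid)
open import Data.List.Relation.Binary.Permutation.Setoid.Properties using (partition-↭; Unique-resp-↭)
open import Data.List.Relation.Unary.All using (All; []; _∷_)
import Data.List.Relation.Unary.All as All
open import Data.List.Relation.Unary.All.Properties using (++⁻ˡ; ++⁻ʳ; all-filter)
open import Data.List.Relation.Unary.AllPairs using (AllPairs; []; _∷_)
import Data.List.Relation.Unary.AllPairs.Properties as AllPairs
open import Data.List.Relation.Unary.Any using (Any; here; there)
open import Data.List.Relation.Unary.Unique.Propositional using (Unique)
import Data.List.Relation.Unary.Unique.Propositional.Properties as Unique
open import Data.Maybe using (Maybe; just; nothing; maybe)
import Data.Maybe as Maybe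
open import Data.Maybe.Relation.Binary.Pointwise using (Pointwise; just; nothing)
open import Data.Nat using (ℕ; zero; suc; _+_; _*_; _∸_; _≤_; _<_; _<?_; _≡ᵇ_; z≤n; s≤s)
open import Data.Nat.Combinatorics using (_C_; nCk+nC[k+1]≡[n+1]C[k+1])
open import Data.Nat.ListAction using (sum)
import Data.Nat.Properties as ℕ
open import Algebra.Properties.CommutativeSemigroup ℕ.+-commutativeSemigroup using (x∙yz≈y∙xz)
open import Data.Product using (Σ-syntax; ∃-syntax; _×_; _,_; proj₁; proj₂)
open import Data.Rational using (ℚ; 0ℚ; 1ℚ; toℚᵘ; _/_) renaming (_+_ to _+ℚ_; _*_ to _*ℚ_)
import Data.Rational.Properties as ℚ
open import Data.Rational.Unnormalised using (mkℚᵘ; _≃_; *≡*)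
import Data.Rational.Unnormalised.Properties as ℚᵘ
open import Data.Sum using (_⊎_; inj₁; inj₂)
open import Data.Unit using (⊤; tt)
open import Function using (_∘_; _∘₂_; Equivalence; mk↔ₛ′)
open import Relation.Binary.PropositionalEquality
  using (_≡_; _≢_; _≗_; refl; sym; trans; cong; cong₂; subst; subst₂; setoid; module ≡-Reasoning)
open import Relation.Nullary using (¬_; ¬?; yes; no)
open import Relation.Nullary.Decidable using (⌊_⌋; toWitness; fromWitness)
open import Relation.Unary.Properties using (∁?)

private
  variable
    A B X Y : Set

countᵇ : (A → Bool) → List A → ℕ
countᵇ b xs = length (filter (T? ∘ b) xs)

length-++-∷ : (ys : List A) {y : A} {zs : List A} →
  length (ys ++ y ∷ zs) ≡ suc (length (ys ++ zs))
length-++-∷ []       = refl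
length-++-∷ (_ ∷ ys) = cong suc (length-++-∷ ys)

Any-++-∷⁻ : {P : A → Set} (ys : List A) {y : A} {zs : List A} →
  Any P (ys ++ y ∷ zs) → ¬ P y → Any P (ys ++ zs)
Any-++-∷⁻ []       (here py) ¬py = ⊥-elim (¬py py)
Any-++-∷⁻ []       (there p) ¬py = p
Any-++-∷⁻ (_ ∷ ys) (here p)  ¬py = here p
Any-++-∷⁻ (_ ∷ ys) (there p) ¬py = there (Any-++-∷⁻ ys p ¬py)

length-≤-pigeonhole : (_≈_ : X → X → Set) (R : X → Y → Set) →
  (∀ x x′ y → R x y → R x′ y → x ≈ x′) →
  (xs : List X) (ys : List Y) → AllPairs (λ a b → ¬ a ≈ b) xs →
  (∀ {x} → x ∈ xs → Any (R x) ys) → length xs ≤ length ys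
length-≤-pigeonhole _≈_ R inj []       ys _          _   = z≤n
length-≤-pigeonhole _≈_ R inj (x ∷ xs) ys (x≉ ∷ xs≉) hit
  with y , y∈ys , Rxy ← find (hit (here refl))
  with ys₁ , ys₂ , refl ← ∈-∃++ y∈ys =
  subst (suc (length xs) ≤_) (sym (length-++-∷ ys₁))
    (s≤s (length-≤-pigeonhole _≈_ R inj xs (ys₁ ++ ys₂) xs≉
      (λ x′∈xs → Any-++-∷⁻ ys₁ (hit (there x′∈xs))
                   (λ Rx′y → All.lookup x≉ x′∈xs (inj x _ y Rxy Rx′y)))))

countᵇ-≤-injection : (f g : A → Bool) (xs ys : List A) (φ : A → A) →
  AllPairs (λ a b → ¬ a ≡ b) xs →
  (∀ {x} → x ∈ xs → T (f x) → φ x ∈ ys × T (g (φ x))) →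
  (∀ {x x′} → x ∈ xs → x′ ∈ xs → φ x ≡ φ x′ → x ≡ x′) →
  countᵇ f xs ≤ countᵇ g ys
countᵇ-≤-injection f g xs ys φ xs-distinct into inj =
  length-≤-pigeonhole _≡_ (λ x y → x ∈ xs × φ x ≡ y)
    (λ _ _ _ (x∈ , φx≡y) (x′∈ , φx′≡y) → inj x∈ x′∈ (trans φx≡y (sym φx′≡y)))
    (filter (T? ∘ f) xs) (filter (T? ∘ g) ys) (AllPairs.filter⁺ (T? ∘ f) xs-distinct) hit
  where
  hit : ∀ {x} → x ∈ filter (T? ∘ f) xs → Any (λ y → x ∈ xs × φ x ≡ y) (filter (T? ∘ g) ys)
  hit x∈ with x∈xs , fx ← ∈-filter⁻ (T? ∘ f) {xs = xs} x∈
         with φx∈ys , gφx ← into x∈xs fx =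
    lose (∈-filter⁺ (T? ∘ g) φx∈ys gφx) (x∈xs , refl)

countᵇ-cong-∈ : (f g : A → Bool) (xs : List A) →
  (∀ {x} → x ∈ xs → f x ≡ g x) → countᵇ f xs ≡ countᵇ g xs
countᵇ-cong-∈ f g []       f≡g = refl
countᵇ-cong-∈ f g (x ∷ xs) f≡g with f x | g x | f≡g (here refl)
... | true  | true  | refl = cong suc (countᵇ-cong-∈ f g xs (f≡g ∘ there))
... | false | false | refl = countᵇ-cong-∈ f g xs (f≡g ∘ there)

countᵇ-filter : (a b : A → Bool) (xs : List A) →
  countᵇ b (filter (T? ∘ a) xs) ≡ countᵇ (λ x → a x ∧ b x) xs
countᵇ-filter a b [] = refl
countᵇ-filter a b (x ∷ xs) with a x
... | false = countᵇ-filter a b xs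
... | true with b x
...   | true  = cong suc (countᵇ-filter a b xs)
...   | false = countᵇ-filter a b xs

countᵇ-∧-const : (a : A → Bool) (c : Bool) (xs : List A) →
  countᵇ (λ x → a x ∧ c) xs ≡ (if c then countᵇ a xs else 0)
countᵇ-∧-const a c [] with c
... | true  = refl
... | false = refl
countᵇ-∧-const a c (x ∷ xs) with a x | c | countᵇ-∧-const a c xs
... | true  | true  | ih = cong suc ih
... | true  | false | ih = ih
... | false | true  | ih = ih
... | false | false | ih = ih

sum-const : (c : ℕ) (xs : List A) → sum (map (λ _ → c) xs) ≡ length xs * c
sum-const c []       = refl
sum-const c (_ ∷ xs) = cong (c +_) (sum-const c xs)

sum-cong-∈ : (f g : A → ℕ) (xs : List A) →
  (∀ {x} → x ∈ xs → f x ≡ g x) → sum (map f xs) ≡ sum (map g xs)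
sum-cong-∈ f g []       f≡g = refl
sum-cong-∈ f g (x ∷ xs) f≡g = cong₂ _+_ (f≡g (here refl)) (sum-cong-∈ f g xs (f≡g ∘ there))

sum-countᵇ-∷ : (h : X → Y → Bool) (x : X) (xs : List X) (ys : List Y) →
  sum (map (λ y → countᵇ (λ x′ → h x′ y) (x ∷ xs)) ys)
    ≡ countᵇ (h x) ys + sum (map (λ y → countᵇ (λ x′ → h x′ y) xs) ys)
sum-countᵇ-∷ h x xs []       = refl
sum-countᵇ-∷ h x xs (y ∷ ys) with h x y | sum-countᵇ-∷ h x xs ys
... | true  | ih = cong suc (trans (cong (countᵇ (λ x′ → h x′ y) xs +_) ih)
                                   (x∙yz≈y∙xz (countᵇ (λ x′ → h x′ y) xs) (countᵇ (h x) ys) _))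
... | false | ih = trans (cong (countᵇ (λ x′ → h x′ y) xs +_) ih)
                         (x∙yz≈y∙xz (countᵇ (λ x′ → h x′ y) xs) (countᵇ (h x) ys) _)

sum-countᵇ-comm : (h : X → Y → Bool) (xs : List X) (ys : List Y) →
  sum (map (λ x → countᵇ (h x) ys) xs) ≡ sum (map (λ y → countᵇ (λ x → h x y) xs) ys)
sum-countᵇ-comm h []       ys = sym (trans (sum-const 0 ys) (ℕ.*-zeroʳ (length ys)))
sum-countᵇ-comm h (x ∷ xs) ys =
  trans (cong (countᵇ (h x) ys +_) (sum-countᵇ-comm h xs ys)) (sym (sum-countᵇ-∷ h x xs ys))

countᵇ≡sum : (b : A → Bool) (xs : List A) → countᵇ b xs ≡ sum (map (λ x → if b x then 1 else 0) xs)
countᵇ≡sum b []       = refl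
countᵇ≡sum b (x ∷ xs) with b x
... | true  = cong suc (countᵇ≡sum b xs)
... | false = countᵇ≡sum b xs

-- Membership proofs in a duplicate-free list are unique, so the two inclusions
-- are mutually inverse and form a bag equality.
unique-⊆⊇⇒↭ : {xs ys : List A} → Unique xs → Unique ys →
  (∀ {z} → z ∈ xs → z ∈ ys) → (∀ {z} → z ∈ ys → z ∈ xs) → xs ↭ ys
unique-⊆⊇⇒↭ {A = A} xs! ys! xs⊆ys ys⊆xs = ∼bag⇒↭ λ {z} →
  mk↔ₛ′ xs⊆ys ys⊆xs (λ _ → unique⇒irrelevant (setoid A) uip ys! _ _)
                    (λ _ → unique⇒irrelevant (setoid A) uip xs! _ _)

unique-resp-↭ : {xs ys : List A} → xs ↭ ys → Unique xs → Unique ys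
unique-resp-↭ {A} xs↭ys = Unique-resp-↭ (setoid A) (↭⇒↭ₛ xs↭ys)

mapMaybe-unique : (f : A → Maybe B) → (∀ {a a′ b} → f a ≡ just b → f a′ ≡ just b → a ≡ a′) →
  {xs : List A} → Unique xs → Unique (mapMaybe f xs)
mapMaybe-unique f f-inj []              = []
mapMaybe-unique f f-inj {x ∷ xs} (x∉ ∷ xs!) with f x in fx
... | nothing = mapMaybe-unique f f-inj xs!
... | just b  = fresh xs x∉ ∷ mapMaybe-unique f f-inj xs!
  where
  fresh : ∀ ys → All (x ≢_) ys → All (b ≢_) (mapMaybe f ys)
  fresh []       []         = []
  fresh (y ∷ ys) (x≢y ∷ x∉) with f y in fy
  ... | nothing = fresh ys x∉
  ... | just c  = (λ { refl → x≢y (f-inj fx fy) }) ∷ fresh ys x∉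

∈-mapMaybe⁺ : (f : A → Maybe B) {x : A} {y : B} {xs : List A} → x ∈ xs → f x ≡ just y → y ∈ mapMaybe f xs
∈-mapMaybe⁺ f {xs = x ∷ xs} (here refl) fx≡y rewrite fx≡y = here refl
∈-mapMaybe⁺ f {xs = z ∷ xs} (there x∈) fx≡y with f z
... | just _  = there (∈-mapMaybe⁺ f x∈ fx≡y)
... | nothing = ∈-mapMaybe⁺ f x∈ fx≡y

∈-mapMaybe⁻ : (f : A → Maybe B) {y : B} (xs : List A) → y ∈ mapMaybe f xs → ∃[ x ] x ∈ xs × f x ≡ just y
∈-mapMaybe⁻ f (x ∷ xs) y∈ with f x in fx
∈-mapMaybe⁻ f (x ∷ xs) (here refl) | just _ = x , here refl , fx
∈-mapMaybe⁻ f (x ∷ xs) (there y∈)  | just _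
  with z , z∈ , fz ← ∈-mapMaybe⁻ f xs y∈ = z , there z∈ , fz
∈-mapMaybe⁻ f (x ∷ xs) y∈          | nothing
  with z , z∈ , fz ← ∈-mapMaybe⁻ f xs y∈ = z , there z∈ , fz

++-injective : {xs xs′ ys ys′ : List A} → length xs ≡ length xs′ → xs ++ ys ≡ xs′ ++ ys′ → xs ≡ xs′ × ys ≡ ys′
++-injective {xs = []}     {[]}      _  e = refl , e
++-injective {xs = x ∷ xs} {x′ ∷ xs′} l e with refl , e′ ← ∷-injective e
  with refl , e″ ← ++-injective {xs = xs} {xs′} (ℕ.suc-injective l) e′ = refl , e″

applyUpTo-cong : {f g : ℕ → A} → f ≗ g → ∀ n → applyUpTo f n ≡ applyUpTo g n
applyUpTo-cong f≗g zero    = refl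
applyUpTo-cong f≗g (suc n) = cong₂ _∷_ (f≗g 0) (applyUpTo-cong (f≗g ∘ suc) n)

applyUpTo-+ : (f : ℕ → A) (a b : ℕ) → applyUpTo f (a + b) ≡ applyUpTo f a ++ applyUpTo (f ∘ (a +_)) b
applyUpTo-+ f zero    b = refl
applyUpTo-+ f (suc a) b = cong (f 0 ∷_) (applyUpTo-+ (f ∘ suc) a b)

T-⇔⇒≡ : {a b : Bool} → (T a → T b) → (T b → T a) → a ≡ b
T-⇔⇒≡ {false} {false} _  _  = refl
T-⇔⇒≡ {false} {true}  _  b⇒a = ⊥-elim (b⇒a tt)
T-⇔⇒≡ {true}  {false} a⇒b _  = ⊥-elim (a⇒b tt)
T-⇔⇒≡ {true}  {true}  _  _  = refl

¬T⇒≡false : {b : Bool} → ¬ T b → b ≡ false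
¬T⇒≡false {false} _  = refl
¬T⇒≡false {true}  ¬t = ⊥-elim (¬t _)

module _ {a b : Bool} where

  T-∧-intro : T a → T b → T (a ∧ b)
  T-∧-intro p q = Equivalence.from T-∧ (p , q)

  T-∨-introˡ : T a → T (a ∨ b)
  T-∨-introˡ p = Equivalence.from T-∨ (inj₁ p)

  T-∨-introʳ : T b → T (a ∨ b)
  T-∨-introʳ p = Equivalence.from T-∨ (inj₂ p)

leaves : Tree A → List A
leaves (leaf a)   = a ∷ []
leaves (node l r) = leaves l ++ leaves r

leafCount-shape : (t : Tree A) → leafCount (shape t) ≡ leafCount t
leafCount-shape (leaf _)   = refl
leafCount-shape (node l r) = cong₂ _+_ (leafCount-shape l) (leafCount-shape r)

leafCount≡length-leaves : (t : Tree A) → leafCount t ≡ length (leaves t)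
leafCount≡length-leaves (leaf _)   = refl
leafCount≡length-leaves (node l r) =
  trans (cong₂ _+_ (leafCount≡length-leaves l) (leafCount≡length-leaves r))
        (sym (length-++ (leaves l)))

mapT-∘ : (f : B → X) (g : A → B) (t : Tree A) → mapT f (mapT g t) ≡ mapT (f ∘ g) t
mapT-∘ f g (leaf a)   = refl
mapT-∘ f g (node l r) = cong₂ node (mapT-∘ f g l) (mapT-∘ f g r)

mapT-cong-leaves : (f g : A → B) (t : Tree A) → All (λ a → f a ≡ g a) (leaves t) → mapT f t ≡ mapT g t
mapT-cong-leaves f g (leaf a)   (fa≡ga ∷ []) = cong leaf fa≡ga
mapT-cong-leaves f g (node l r) f≡g =
  cong₂ node (mapT-cong-leaves f g l (++⁻ˡ (leaves l) f≡g)) (mapT-cong-leaves f g r (++⁻ʳ (leaves l) f≡g))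

mapT-id : (t : Tree A) → mapT (λ a → a) t ≡ t
mapT-id (leaf a)   = refl
mapT-id (node l r) = cong₂ node (mapT-id l) (mapT-id r)

leaves-mapT : (f : A → B) (t : Tree A) → leaves (mapT f t) ≡ map f (leaves t)
leaves-mapT f (leaf a)   = refl
leaves-mapT f (node l r) =
  trans (cong₂ _++_ (leaves-mapT f l) (leaves-mapT f r)) (sym (map-++ f (leaves l) (leaves r)))

shape-mapT : (f : A → B) (t : Tree A) → shape (mapT f t) ≡ shape t
shape-mapT f = mapT-∘ _ f

iso-node⁻ : {eq : A → A → Bool} (l r l′ r′ : Tree A) → T (iso eq (node l r) (node l′ r′)) →
  (T (iso eq l l′) × T (iso eq r r′)) ⊎ (T (iso eq l r′) × T (iso eq r l′))
iso-node⁻ l r l′ r′ p with Equivalence.to T-∨ p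
... | inj₁ q = inj₁ (Equivalence.to T-∧ q)
... | inj₂ q = inj₂ (Equivalence.to T-∧ q)

module IsoEquivalence {A : Set} (eq : A → A → Bool)
  (eq-refl : ∀ a → T (eq a a)) (eq-sym : ∀ a b → T (eq a b) → T (eq b a))
  (eq-trans : ∀ a b c → T (eq a b) → T (eq b c) → T (eq a c)) where

  iso-refl : ∀ t → T (iso eq t t)
  iso-refl (leaf a)   = eq-refl a
  iso-refl (node l r) = T-∨-introˡ (T-∧-intro (iso-refl l) (iso-refl r))

  iso-sym : ∀ t u → T (iso eq t u) → T (iso eq u t)
  iso-sym (leaf a)   (leaf b)     p = eq-sym a b p
  iso-sym (node l r) (node l′ r′) p with iso-node⁻ l r l′ r′ p
  ... | inj₁ (p₁ , p₂) = T-∨-introˡ (T-∧-intro (iso-sym l l′ p₁) (iso-sym r r′ p₂))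
  ... | inj₂ (p₁ , p₂) = T-∨-introʳ (T-∧-intro (iso-sym r l′ p₂) (iso-sym l r′ p₁))

  iso-trans : ∀ t u v → T (iso eq t u) → T (iso eq u v) → T (iso eq t v)
  iso-trans (leaf a) (leaf b) (leaf c) p q = eq-trans a b c p q
  iso-trans (node l r) (node l′ r′) (node l″ r″) p q with iso-node⁻ l r l′ r′ p | iso-node⁻ l′ r′ l″ r″ q
  ... | inj₁ (p₁ , p₂) | inj₁ (q₁ , q₂) = T-∨-introˡ (T-∧-intro (iso-trans l l′ l″ p₁ q₁) (iso-trans r r′ r″ p₂ q₂))
  ... | inj₁ (p₁ , p₂) | inj₂ (q₁ , q₂) = T-∨-introʳ (T-∧-intro (iso-trans l l′ r″ p₁ q₁) (iso-trans r r′ l″ p₂ q₂))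
  ... | inj₂ (p₁ , p₂) | inj₁ (q₁ , q₂) = T-∨-introʳ (T-∧-intro (iso-trans l r′ r″ p₁ q₂) (iso-trans r l′ l″ p₂ q₁))
  ... | inj₂ (p₁ , p₂) | inj₂ (q₁ , q₂) = T-∨-introˡ (T-∧-intro (iso-trans l r′ l″ p₁ q₂) (iso-trans r l′ r″ p₂ q₁))

_≈ₗ_ : {k : ℕ} → Tree (Fin k) → Tree (Fin k) → Set
Q ≈ₗ Q′ = T (Q ≅ₗ Q′)

module ≅ₗ {k : ℕ} = IsoEquivalence (λ (i j : Fin k) → ⌊ i ≟ j ⌋)
  (λ i → fromWitness refl) (λ i j p → fromWitness (sym (toWitness p)))
  (λ i j l p q → fromWitness (trans (toWitness p) (toWitness q)))

module ≅ₛ = IsoEquivalence {⊤} (λ _ _ → true) (λ _ → tt) (λ _ _ _ → tt) (λ _ _ _ _ _ → tt)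

iso-mapT : (eq : A → A → Bool) (eq′ : B → B → Bool) (f : A → B) →
  (∀ a b → T (eq a b) → T (eq′ (f a) (f b))) →
  ∀ t u → T (iso eq t u) → T (iso eq′ (mapT f t) (mapT f u))
iso-mapT eq eq′ f f-resp (leaf a) (leaf b) p = f-resp a b p
iso-mapT eq eq′ f f-resp (node l r) (node l′ r′) p with iso-node⁻ l r l′ r′ p
... | inj₁ (p₁ , p₂) = T-∨-introˡ (T-∧-intro (iso-mapT eq eq′ f f-resp l l′ p₁) (iso-mapT eq eq′ f f-resp r r′ p₂))
... | inj₂ (p₁ , p₂) = T-∨-introʳ (T-∧-intro (iso-mapT eq eq′ f f-resp l r′ p₁) (iso-mapT eq eq′ f f-resp r l′ p₂))

≈ₗ⇒≅ₛ : {k : ℕ} (Q Q′ : Tree (Fin k)) → Q ≈ₗ Q′ → T (shape Q ≅ₛ shape Q′)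
≈ₗ⇒≅ₛ = iso-mapT _ _ _ (λ _ _ _ → tt)

≈ₗ-mapT : {k : ℕ} (f : Fin k → Fin k) (Q Q′ : Tree (Fin k)) → Q ≈ₗ Q′ → mapT f Q ≈ₗ mapT f Q′
≈ₗ-mapT f = iso-mapT _ _ f (λ _ _ p → fromWitness (cong f (toWitness p)))

≈ₗ⇒leaves-↭ : {k : ℕ} (Q Q′ : Tree (Fin k)) → Q ≈ₗ Q′ → leaves Q ↭ leaves Q′
≈ₗ⇒leaves-↭ (leaf a) (leaf b) p with refl ← toWitness p = ↭-refl
≈ₗ⇒leaves-↭ (node l r) (node l′ r′) p with iso-node⁻ l r l′ r′ p
... | inj₁ (p₁ , p₂) = ++⁺ (≈ₗ⇒leaves-↭ l l′ p₁) (≈ₗ⇒leaves-↭ r r′ p₂)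
... | inj₂ (p₁ , p₂) =
  ↭-trans (++⁺ (≈ₗ⇒leaves-↭ l r′ p₁) (≈ₗ⇒leaves-↭ r l′ p₂)) (++-comm (leaves r′) (leaves l′))

-- Swap the children wherever the shape isomorphism crosses them.
≅ₛ-lift : (eq : A → A → Bool) → (∀ a → T (eq a a)) →
  (Q : Tree A) (S : Shape) → T (shape Q ≅ₛ S) →
  Σ[ Q′ ∈ Tree A ] T (iso eq Q Q′) × shape Q′ ≡ S
≅ₛ-lift eq eq-refl (leaf a) (leaf tt) p = leaf a , eq-refl a , refl
≅ₛ-lift eq eq-refl (node l r) (node l′ r′) p with iso-node⁻ (shape l) (shape r) l′ r′ p
... | inj₁ (p₁ , p₂) =
  let L , Lp , Le = ≅ₛ-lift eq eq-refl l l′ p₁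
      R , Rp , Re = ≅ₛ-lift eq eq-refl r r′ p₂
  in node L R , T-∨-introˡ (T-∧-intro Lp Rp) , cong₂ node Le Re
... | inj₂ (p₁ , p₂) =
  let L , Lp , Le = ≅ₛ-lift eq eq-refl l r′ p₁
      R , Rp , Re = ≅ₛ-lift eq eq-refl r l′ p₂
  in node R L , T-∨-introʳ (T-∧-intro Lp Rp) , cong₂ node Re Le

nodeᴹ : Maybe (Tree B) → Maybe (Tree B) → Maybe (Tree B)
nodeᴹ (just l) (just r) = just (node l r)
nodeᴹ (just l) nothing  = just l
nodeᴹ nothing  r        = r

restrict-leaf : (f : A → Maybe B) (a : A) → restrict f (leaf a) ≡ Maybe.map leaf (f a)
restrict-leaf f a with f a
... | just b  = refl
... | nothing = refl

restrict-node : (f : A → Maybe B) (l r : Tree A) →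
  restrict f (node l r) ≡ nodeᴹ (restrict f l) (restrict f r)
restrict-node f l r with restrict f l | restrict f r
... | just _  | just _  = refl
... | just _  | nothing = refl
... | nothing | just _  = refl
... | nothing | nothing = refl

restrict-cong-leaves : (f g : A → Maybe B) (t : Tree A) →
  All (λ a → f a ≡ g a) (leaves t) → restrict f t ≡ restrict g t
restrict-cong-leaves f g (leaf a) (fa≡ga ∷ []) =
  trans (restrict-leaf f a) (trans (cong (Maybe.map leaf) fa≡ga) (sym (restrict-leaf g a)))
restrict-cong-leaves f g (node l r) f≡g =
  trans (restrict-node f l r)
    (trans (cong₂ nodeᴹ (restrict-cong-leaves f g l (++⁻ˡ (leaves l) f≡g))
                        (restrict-cong-leaves f g r (++⁻ʳ (leaves l) f≡g)))
           (sym (restrict-node g l r)))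

restrict-mapT : (f : B → Maybe X) (g : A → B) (t : Tree A) →
  restrict f (mapT g t) ≡ restrict (f ∘ g) t
restrict-mapT f g (leaf a) = trans (restrict-leaf f (g a)) (sym (restrict-leaf (f ∘ g) a))
restrict-mapT f g (node l r) =
  trans (restrict-node f (mapT g l) (mapT g r))
    (trans (cong₂ nodeᴹ (restrict-mapT f g l) (restrict-mapT f g r)) (sym (restrict-node (f ∘ g) l r)))

shape-nodeᴹ : (x y : Maybe (Tree B)) →
  Maybe.map shape (nodeᴹ x y) ≡ nodeᴹ (Maybe.map shape x) (Maybe.map shape y)
shape-nodeᴹ (just _) (just _) = refl
shape-nodeᴹ (just _) nothing  = refl
shape-nodeᴹ nothing  _        = refl

shape-restrict : (f : A → Maybe B) (t : Tree A) →
  Maybe.map shape (restrict f t) ≡ restrict (Maybe.map (λ _ → tt) ∘ f) t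
shape-restrict f (leaf a) with f a
... | just _  = refl
... | nothing = refl
shape-restrict f (node l r) =
  trans (cong (Maybe.map shape) (restrict-node f l r))
    (trans (shape-nodeᴹ (restrict f l) (restrict f r))
      (trans (cong₂ nodeᴹ (shape-restrict f l) (shape-restrict f r)) (sym (restrict-node _ l r))))

leavesᴹ : Maybe (Tree B) → List B
leavesᴹ = maybe leaves []

leavesᴹ-nodeᴹ : (x y : Maybe (Tree B)) → leavesᴹ (nodeᴹ x y) ≡ leavesᴹ x ++ leavesᴹ y
leavesᴹ-nodeᴹ (just _) (just _) = refl
leavesᴹ-nodeᴹ (just l) nothing  = sym (++-identityʳ (leaves l))
leavesᴹ-nodeᴹ nothing  _        = refl

leaves-restrict : (f : A → Maybe B) (t : Tree A) → leavesᴹ (restrict f t) ≡ mapMaybe f (leaves t)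
leaves-restrict f (leaf a) with f a
... | just _  = refl
... | nothing = refl
leaves-restrict f (node l r) =
  trans (cong leavesᴹ (restrict-node f l r))
    (trans (leavesᴹ-nodeᴹ (restrict f l) (restrict f r))
      (trans (cong₂ _++_ (leaves-restrict f l) (leaves-restrict f r))
             (sym (mapMaybe-++ f (leaves l) (leaves r)))))

_≅ᴹ_ : Maybe Shape → Maybe Shape → Set
_≅ᴹ_ = Pointwise (λ s t → T (s ≅ₛ t))

nodeᴹ-straight : ∀ {x x′ y y′} → x ≅ᴹ x′ → y ≅ᴹ y′ → nodeᴹ x y ≅ᴹ nodeᴹ x′ y′
nodeᴹ-straight (just p) (just q) = just (T-∨-introˡ (T-∧-intro p q))
nodeᴹ-straight (just p) nothing  = just p
nodeᴹ-straight nothing  q        = q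

nodeᴹ-crossed : ∀ {x x′ y y′} → x ≅ᴹ y′ → y ≅ᴹ x′ → nodeᴹ x y ≅ᴹ nodeᴹ x′ y′
nodeᴹ-crossed {x′ = just _}  (just p) (just q) = just (T-∨-introʳ (T-∧-intro p q))
nodeᴹ-crossed {x′ = nothing} (just p) nothing  = just p
nodeᴹ-crossed {x′ = just _}  nothing  (just q) = just q
nodeᴹ-crossed {x′ = nothing} nothing  nothing  = nothing

restrict-iso : (eq : A → A → Bool) (f : A → Maybe ⊤) → (∀ a b → T (eq a b) → f a ≡ f b) →
  ∀ t u → T (iso eq t u) → restrict f t ≅ᴹ restrict f u
restrict-iso eq f f-resp (leaf a) (leaf b) p
  rewrite restrict-leaf f a | restrict-leaf f b | f-resp a b p with f b
... | just tt = just tt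
... | nothing = nothing
restrict-iso eq f f-resp (node l r) (node l′ r′) p
  rewrite restrict-node f l r | restrict-node f l′ r′ with iso-node⁻ l r l′ r′ p
... | inj₁ (p₁ , p₂) = nodeᴹ-straight (restrict-iso eq f f-resp l l′ p₁) (restrict-iso eq f f-resp r r′ p₂)
... | inj₂ (p₁ , p₂) = nodeᴹ-crossed (restrict-iso eq f f-resp l r′ p₁) (restrict-iso eq f f-resp r l′ p₂)

hasShape : Shape → Maybe Shape → Bool
hasShape S′ (just R) = R ≅ₛ S′
hasShape S′ nothing  = false

hasShape-resp : (S′ : Shape) {x y : Maybe Shape} → x ≅ᴹ y → hasShape S′ x ≡ hasShape S′ y
hasShape-resp S′ nothing = refl
hasShape-resp S′ {just x} {just y} (just p) =
  T-⇔⇒≡ (≅ₛ.iso-trans y x S′ (≅ₛ.iso-sym x y p)) (≅ₛ.iso-trans x y S′ p)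

∈-insertAll⁺ : (x : A) (ys zs : List A) → ys ++ x ∷ zs ∈ insertAll x (ys ++ zs)
∈-insertAll⁺ x []       []      = here refl
∈-insertAll⁺ x []       (_ ∷ _) = here refl
∈-insertAll⁺ x (y ∷ ys) zs      = there (∈-map⁺ (y ∷_) (∈-insertAll⁺ x ys zs))

∈-insertAll⁻ : (x : A) (zs : List A) {ys : List A} → ys ∈ insertAll x zs → ys ↭ x ∷ zs
∈-insertAll⁻ x []       (here refl) = ↭-refl
∈-insertAll⁻ x (z ∷ zs) (here refl) = ↭-refl
∈-insertAll⁻ x (z ∷ zs) (there p) with ws , ws∈ , refl ← ∈-map⁻ (z ∷_) p =
  ↭-trans (prep z (∈-insertAll⁻ x zs ws∈)) (swap z x ↭-refl)

∈-perms⁻ : (xs : List A) {ys : List A} → ys ∈ perms xs → ys ↭ xs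
∈-perms⁻ []       (here refl) = ↭-refl
∈-perms⁻ (x ∷ xs) p with zs , zs∈ , ys∈ ← find (∈-concatMap⁻ (insertAll x) p) =
  ↭-trans (∈-insertAll⁻ x zs ys∈) (prep x (∈-perms⁻ xs zs∈))

∈-perms⁺ : (xs : List A) {ys : List A} → ys ↭ xs → ys ∈ perms xs
∈-perms⁺ []       p with refl ← ↭-empty-inv p = here refl
∈-perms⁺ (x ∷ xs) p with ys₁ , ys₂ , refl ← ∈-∃++ (∈-resp-↭ (↭-sym p) (here refl)) =
  ∈-concatMap⁺ (insertAll x) (lose (∈-perms⁺ xs (drop-mid ys₁ [] p)) (∈-insertAll⁺ x ys₁ ys₂))

leafCount-suc : (t : Tree A) → ∃[ k ] leafCount t ≡ suc k
leafCount-suc (leaf _)   = 0 , refl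
leafCount-suc (node l r) with k , e ← leafCount-suc l = k + leafCount r , cong (_+ leafCount r) e

node∈shapesF : ∀ f {l r : Shape} a b → l ∈ shapesF f (suc a) → r ∈ shapesF f (suc b) →
  node l r ∈ shapesF (suc f) (suc a + suc b)
node∈shapesF f {l} {r} a b l∈ r∈ rewrite ℕ.+-suc a b =
  ∈-concatMap⁺ _ (lose (∈-upTo⁺ (s≤s (ℕ.m≤m+n a b)))
    (∈-concatMap⁺ _ (lose l∈ (∈-map⁺ (node l) (subst (λ k → r ∈ shapesF f k) (sym rest) r∈)))))
  where
  rest : suc (a + b) ∸ a ≡ suc b
  rest = trans (cong (_∸ a) (sym (ℕ.+-suc a b))) (ℕ.m+n∸m≡n a (suc b))

∈-shapesF⁺ : ∀ f (s : Shape) → leafCount s ≤ f → s ∈ shapesF f (leafCount s)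
∈-shapesF⁺ zero    s          s≤0 with k , e ← leafCount-suc s with () ← subst (_≤ 0) e s≤0
∈-shapesF⁺ (suc f) (leaf tt)  _   = here refl
∈-shapesF⁺ (suc f) (node l r) s≤f with a , la ← leafCount-suc l | b , lb ← leafCount-suc r =
  subst (λ k → node l r ∈ shapesF (suc f) k) (sym (cong₂ _+_ la lb))
    (node∈shapesF f a b (subst (λ k → l ∈ shapesF f k) la (∈-shapesF⁺ f l l≤f))
                        (subst (λ k → r ∈ shapesF f k) lb (∈-shapesF⁺ f r r≤f)))
  where
  l≤f : leafCount l ≤ f
  l≤f = ℕ.≤-pred (ℕ.≤-trans (ℕ.m<m+n (leafCount l) (subst (0 Data.Nat.<_) (sym lb) (s≤s z≤n))) s≤f)
  r≤f : leafCount r ≤ f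
  r≤f = ℕ.≤-pred (ℕ.≤-trans (ℕ.m<n+m (leafCount r) (subst (0 Data.Nat.<_) (sym la) (s≤s z≤n))) s≤f)

fill-sound : (s : Shape) (as : List A) {t : Tree A} {rest : List A} →
  fill s as ≡ just (t , rest) → as ≡ leaves t ++ rest × shape t ≡ s
fill-sound (leaf tt) (a ∷ as) refl = refl , refl
fill-sound (node l r) as e with fill l as in el
... | just (l′ , as′) with fill r as′ in er
...   | just (r′ , as″) with refl ← e
  with as≡ , sl ← fill-sound l as el | as′≡ , sr ← fill-sound r as′ er =
  trans as≡ (trans (cong (leaves l′ ++_) as′≡) (sym (++-assoc (leaves l′) (leaves r′) as″))) ,
  cong₂ node sl sr

fill-leaves : (t : Tree A) (rest : List A) → fill (shape t) (leaves t ++ rest) ≡ just (t , rest)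
fill-leaves (leaf a)   rest = refl
fill-leaves (node l r) rest
  rewrite ++-assoc (leaves l) (leaves r) rest | fill-leaves l (leaves r ++ rest) | fill-leaves r rest = refl

fillAll-sound : (s : Shape) (as : List A) {t : Tree A} → fillAll s as ≡ just t → as ≡ leaves t
fillAll-sound s as e with fill s as in e′
... | just (t , []) with refl ← e = trans (proj₁ (fill-sound s as e′)) (++-identityʳ (leaves t))

fillAll-leaves : (t : Tree A) → fillAll (shape t) (leaves t) ≡ just t
fillAll-leaves t
  rewrite subst (λ as → fill (shape t) as ≡ just (t , [])) (++-identityʳ (leaves t)) (fill-leaves t []) = refl

length-allFin : (k : ℕ) → length (allFin k) ≡ k
length-allFin k = length-tabulate {n = k} (λ i → i)

Bijective : (k : ℕ) → Tree (Fin k) → Set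
Bijective k t = leaves t ↭ allFin k

leafCount-bijective : (k : ℕ) (t : Tree (Fin k)) → Bijective k t → leafCount t ≡ k
leafCount-bijective k t bij =
  trans (leafCount≡length-leaves t) (trans (↭-length bij) (length-allFin k))

∈-planarLabelled⁺ : (k : ℕ) (t : Tree (Fin k)) → Bijective k t → t ∈ planarLabelled k
∈-planarLabelled⁺ k t bij =
  ∈-concatMap⁺ _ (lose shape∈ (∈-mapMaybe⁺ (fillAll (shape t)) (∈-perms⁺ (allFin k) bij) (fillAll-leaves t)))
  where
  lc : leafCount (shape t) ≡ k
  lc = trans (leafCount-shape t) (leafCount-bijective k t bij)
  shape∈ : shape t ∈ planarShapes k
  shape∈ = subst (λ j → shape t ∈ shapesF k j) lc (∈-shapesF⁺ k (shape t) (ℕ.≤-reflexive lc))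

∈-planarLabelled⁻ : (k : ℕ) {t : Tree (Fin k)} → t ∈ planarLabelled k → Bijective k t
∈-planarLabelled⁻ k t∈
  with s , _ , t∈′ ← find (∈-concatMap⁻ _ {xs = planarShapes k} t∈)
  with as , as∈ , e ← ∈-mapMaybe⁻ (fillAll s) (perms (allFin k)) t∈′ =
  subst (_↭ allFin k) (fillAll-sound s as e) (∈-perms⁻ (allFin k) as∈)

module Deduplicateᵇ {A : Set} (r : A → A → Bool) (r-refl : ∀ a → T (r a a))
  (r-sym : ∀ a b → T (r a b) → T (r b a))
  (r-trans : ∀ a b c → T (r a b) → T (r b c) → T (r a c)) where

  deduplicateᵇ-distinct : (xs : List A) → AllPairs (λ a b → ¬ T (r a b)) (deduplicateᵇ r xs)
  deduplicateᵇ-distinct []       = []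
  deduplicateᵇ-distinct (y ∷ xs) =
    all-filter (¬? ∘ T? ∘ r y) (deduplicateᵇ r xs) ∷ AllPairs.filter⁺ (¬? ∘ T? ∘ r y) (deduplicateᵇ-distinct xs)

  deduplicateᵇ-complete : (xs : List A) {x : A} →
    x ∈ xs → Any (λ w → T (r x w)) (deduplicateᵇ r xs)
  deduplicateᵇ-complete (y ∷ xs) (here refl) = here (r-refl y)
  deduplicateᵇ-complete (y ∷ xs) {x} (there x∈)
    with w , w∈ , rxw ← find (deduplicateᵇ-complete xs x∈) | r y w in ryw
  ... | true  = here (r-trans x w y rxw (r-sym y w (subst T (sym ryw) tt)))
  ... | false = there (lose (∈-filter⁺ (¬? ∘ T? ∘ r y) w∈ (subst (¬_ ∘ T) (sym ryw) λ ())) rxw)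

module RBL {k : ℕ} = Deduplicateᵇ (_≅ₗ_ {k}) ≅ₗ.iso-refl ≅ₗ.iso-sym ≅ₗ.iso-trans

∈-RBL⁻ : (k : ℕ) {Q : Tree (Fin k)} → Q ∈ RBL k → Bijective k Q
∈-RBL⁻ k Q∈ = ∈-planarLabelled⁻ k (∈-deduplicate⁻ (T? ∘₂ _≅ₗ_) (planarLabelled k) Q∈)

∈-RBL⁺ : (k : ℕ) (Q : Tree (Fin k)) → Bijective k Q → Any (Q ≈ₗ_) (RBL k)
∈-RBL⁺ k Q bij = RBL.deduplicateᵇ-complete (planarLabelled k) (∈-planarLabelled⁺ k Q bij)

RBL-distinct : (k : ℕ) → AllPairs (λ Q Q′ → ¬ Q ≈ₗ Q′) (RBL k)
RBL-distinct k = RBL.deduplicateᵇ-distinct (planarLabelled k)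

toFirst-toℕ : (m n : ℕ) {i : Fin m} {j : Fin n} → toFirst m n i ≡ just j → toℕ j ≡ toℕ i
toFirst-toℕ m n {i} e with toℕ i <? n
toFirst-toℕ m n refl | yes p = toℕ-fromℕ< p

toFirst-injective : (m n : ℕ) {i i′ : Fin m} {j : Fin n} →
  toFirst m n i ≡ just j → toFirst m n i′ ≡ just j → i ≡ i′
toFirst-injective m n e e′ = toℕ-injective (trans (sym (toFirst-toℕ m n e)) (toFirst-toℕ m n e′))

toFirst-inject≤ : (m n : ℕ) (n≤m : n ≤ m) (a : Fin n) → toFirst m n (inject≤ a n≤m) ≡ just a
toFirst-inject≤ m n n≤m a with toℕ (inject≤ a n≤m) <? n
... | yes p = cong just (toℕ-injective (trans (toℕ-fromℕ< p) (toℕ-inject≤ a n≤m)))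
... | no ¬p = ⊥-elim (¬p (subst (_< n) (sym (toℕ-inject≤ a n≤m)) (toℕ<n a)))

mapMaybe-toFirst-↭ : (m n : ℕ) → n ≤ m → {xs : List (Fin m)} → xs ↭ allFin m →
  mapMaybe (toFirst m n) xs ↭ allFin n
mapMaybe-toFirst-↭ m n n≤m xs↭ =
  unique-⊆⊇⇒↭ (mapMaybe-unique (toFirst m n) (toFirst-injective m n) (unique-resp-↭ (↭-sym xs↭) (Unique.allFin⁺ m)))
    (Unique.allFin⁺ n) (λ {a} _ → ∈-allFin a)
    (λ {a} _ → ∈-mapMaybe⁺ (toFirst m n) (∈-resp-↭ (↭-sym xs↭) (∈-allFin (inject≤ a n≤m))) (toFirst-inject≤ m n n≤m a))

restrictTo-bijective : (m n : ℕ) → 1 ≤ n → n ≤ m → (Q : Tree (Fin m)) → Bijective m Q →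
  Σ[ R ∈ Tree (Fin n) ] restrictTo m n Q ≡ just R × Bijective n R
restrictTo-bijective m n (s≤s _) n≤m Q bij
  with restrict (toFirst m n) Q | leaves-restrict (toFirst m n) Q
... | nothing | e with () ← trans (↭-length (subst (_↭ allFin n) (sym e) (mapMaybe-toFirst-↭ m n n≤m bij))) (length-allFin n)
... | just R  | e = R , refl , subst (_↭ allFin n) (sym e) (mapMaybe-toFirst-↭ m n n≤m bij)

toℚᵘ-/ : ∀ k d → toℚᵘ (ℤ.+ k / suc d) ≃ mkℚᵘ (ℤ.+ k) d
toℚᵘ-/ k d = ℚ.toℚᵘ-fromℚᵘ (mkℚᵘ (ℤ.+ k) d)

ℕtoℚ-+ : ∀ a b → ℕtoℚ (a + b) ≡ ℕtoℚ a +ℚ ℕtoℚ b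
ℕtoℚ-+ a b = ℚ.toℚᵘ-injective (ℚᵘ.≃-trans (toℚᵘ-/ (a + b) 0) (ℚᵘ.≃-sym
  (ℚᵘ.≃-trans (ℚ.toℚᵘ-homo-+ (ℕtoℚ a) (ℕtoℚ b)) (ℚᵘ.≃-trans (ℚᵘ.+-cong (toℚᵘ-/ a 0) (toℚᵘ-/ b 0)) (*≡* cross)))))
  where
  cross : (ℤ.+ a ℤ.* ℤ.+ 1 ℤ.+ ℤ.+ b ℤ.* ℤ.+ 1) ℤ.* ℤ.+ 1 ≡ ℤ.+ (a + b) ℤ.* ℤ.+ 1
  cross = trans (ℤ.*-identityʳ _) (trans (cong₂ ℤ._+_ (ℤ.*-identityʳ (ℤ.+ a)) (ℤ.*-identityʳ (ℤ.+ b)))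
            (trans (sym (ℤ.pos-+ a b)) (sym (ℤ.*-identityʳ _))))

sumℚ-if : (b : A → Bool) (c : ℚ) (xs : List A) →
  sumℚ (map (λ x → if b x then c else 0ℚ) xs) ≡ ℕtoℚ (countᵇ b xs) *ℚ c
sumℚ-if b c [] = sym (ℚ.*-zeroˡ c)
sumℚ-if b c (x ∷ xs) with b x
... | false = trans (ℚ.+-identityˡ _) (sumℚ-if b c xs)
... | true  = trans (cong₂ _+ℚ_ (sym (ℚ.*-identityˡ c)) (sumℚ-if b c xs))
   (trans (sym (ℚ.*-distribʳ-+ c 1ℚ (ℕtoℚ (countᵇ b xs)))) (cong (_*ℚ c) (sym (ℕtoℚ-+ 1 (countᵇ b xs)))))

sumℚ-scale : (g : A → ℕ) (c : ℚ) (xs : List A) →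
  sumℚ (map (λ x → ℕtoℚ (g x) *ℚ c) xs) ≡ ℕtoℚ (sum (map g xs)) *ℚ c
sumℚ-scale g c []       = sym (ℚ.*-zeroˡ c)
sumℚ-scale g c (x ∷ xs) = trans (cong (ℕtoℚ (g x) *ℚ c +ℚ_) (sumℚ-scale g c xs))
  (trans (sym (ℚ.*-distribʳ-+ c (ℕtoℚ (g x)) _)) (cong (_*ℚ c) (sym (ℕtoℚ-+ (g x) _))))

ℕtoℚ*invℕ-cross : ∀ N I {a c} → 0 < a → 0 < c → N * c ≡ a * I → ℕtoℚ N *ℚ invℕ a ≡ ℕtoℚ I *ℚ invℕ c
ℕtoℚ*invℕ-cross N I {suc o} {suc c} _ _ N*c≡a*I = ℚ.toℚᵘ-injective
  (ℚᵘ.≃-trans (ℚ.toℚᵘ-homo-* (ℕtoℚ N) (invℕ (suc o)))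
  (ℚᵘ.≃-trans (ℚᵘ.*-cong (toℚᵘ-/ N 0) (toℚᵘ-/ 1 o))
  (ℚᵘ.≃-trans (*≡* cross)
  (ℚᵘ.≃-sym (ℚᵘ.≃-trans (ℚ.toℚᵘ-homo-* (ℕtoℚ I) (invℕ (suc c))) (ℚᵘ.*-cong (toℚᵘ-/ I 0) (toℚᵘ-/ 1 c)))))))
  where
  cross : (ℤ.+ N ℤ.* ℤ.+ 1) ℤ.* ℤ.+ (1 * suc c) ≡ (ℤ.+ I ℤ.* ℤ.+ 1) ℤ.* ℤ.+ (1 * suc o)
  cross rewrite ℤ.*-identityʳ (ℤ.+ N) | ℤ.*-identityʳ (ℤ.+ I) | ℕ.*-identityˡ (suc c) | ℕ.*-identityˡ (suc o) =
    trans (sym (ℤ.pos-* N (suc c))) (trans (cong ℤ.+_ (trans N*c≡a*I (ℕ.*-comm (suc o) I))) (ℤ.pos-* I (suc o)))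

-- The pushforward of p_T

firstHasShape : (m n : ℕ) → Shape → Tree (Fin m) → Bool
firstHasShape m n S′ Q = hasShape S′ (Maybe.map shape (restrictTo m n Q))

module _ (n : ℕ) (S′ : Shape) (R : Tree (Fin n)) where

  private
    classOf-R : List (Tree (Fin n))
    classOf-R = filter (T? ∘ (R ≅ₗ_)) (O n S′)

    classOf-R-distinct : AllPairs (λ a b → ¬ a ≈ₗ b) classOf-R
    classOf-R-distinct = AllPairs.filter⁺ _ (AllPairs.filter⁺ _ (RBL-distinct n))

    ∈-classOf-R⁻ : ∀ {S} → S ∈ classOf-R → R ≈ₗ S × T (shape S ≅ₛ S′)
    ∈-classOf-R⁻ S∈ with S∈O , R≈S ← ∈-filter⁻ (T? ∘ (R ≅ₗ_)) {xs = O n S′} S∈ =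
      R≈S , proj₂ (∈-filter⁻ (T? ∘ (λ S → shape S ≅ₛ S′)) {xs = RBL n} S∈O)

    ≈ₗ-shared : (S₁ S₂ Q : Tree (Fin n)) → S₁ ≈ₗ Q → S₂ ≈ₗ Q → S₁ ≈ₗ S₂
    ≈ₗ-shared S₁ S₂ Q S₁≈Q S₂≈Q = ≅ₗ.iso-trans S₁ Q S₂ S₁≈Q (≅ₗ.iso-sym S₂ Q S₂≈Q)

    classOf-R-≤ : (ys : List (Tree (Fin n))) → (∀ {S} → S ∈ classOf-R → Any (S ≈ₗ_) ys) →
      length classOf-R ≤ length ys
    classOf-R-≤ ys = length-≤-pigeonhole (_≈ₗ_ {n}) _≈ₗ_ ≈ₗ-shared classOf-R ys classOf-R-distinct

  countᵇ-≅ₗ-O : Bijective n R → countᵇ (R ≅ₗ_) (O n S′) ≡ (if shape R ≅ₛ S′ then 1 else 0)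
  countᵇ-≅ₗ-O bij with shape R ≅ₛ S′ in R≅S′
  ... | true  = ℕ.≤-antisym
    (classOf-R-≤ [ R ] (λ S∈ → here (≅ₗ.iso-sym R _ (proj₁ (∈-classOf-R⁻ S∈)))))
    (length-≤-pigeonhole (_≈ₗ_ {n}) _≈ₗ_ ≈ₗ-shared [ R ] classOf-R (All.[] AllPairs.∷ AllPairs.[])
      λ { (here refl) → representative })
    where
    representative : Any (R ≈ₗ_) classOf-R
    representative with w , w∈ , R≈w ← find (∈-RBL⁺ n R bij) =
      lose (∈-filter⁺ (T? ∘ (R ≅ₗ_)) (∈-filter⁺ (T? ∘ (λ S → shape S ≅ₛ S′)) w∈
              (≅ₛ.iso-trans (shape w) (shape R) S′ (≅ₛ.iso-sym (shape R) (shape w) (≈ₗ⇒≅ₛ R w R≈w))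
                            (subst T (sym R≅S′) _))) R≈w) R≈w
  ... | false = ℕ.n≤0⇒n≡0 (classOf-R-≤ [] λ {S} S∈ → ⊥-elim (subst T R≅S′
    (≅ₛ.iso-trans (shape R) (shape S) S′ (≈ₗ⇒≅ₛ R S (proj₁ (∈-classOf-R⁻ S∈))) (proj₂ (∈-classOf-R⁻ S∈)))))

module _ (m n : ℕ) (1≤n : 1 ≤ n) (n≤m : n ≤ m) (S′ T₀ : Shape) where

  private
    matchesFirst : Tree (Fin m) → Tree (Fin n) → Bool
    matchesFirst Q S = matches (restrictTo m n Q) S

    fibreSize : Tree (Fin n) → ℕ
    fibreSize S = countᵇ (λ Q → shape Q ≅ₛ T₀) (filter (λ Q → T? (matchesFirst Q S)) (RBL m))

    count-per-Q : (Q : Tree (Fin m)) → Bijective m Q →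
      countᵇ (λ S → matchesFirst Q S ∧ (shape Q ≅ₛ T₀)) (O n S′)
        ≡ (if (shape Q ≅ₛ T₀) ∧ firstHasShape m n S′ Q then 1 else 0)
    count-per-Q Q bij with R , eR , bijR ← restrictTo-bijective m n 1≤n n≤m Q bij
      rewrite countᵇ-∧-const (matchesFirst Q) (shape Q ≅ₛ T₀) (O n S′) | eR with shape Q ≅ₛ T₀
    ... | true  = countᵇ-≅ₗ-O n S′ R bijR
    ... | false = refl

  πShape-p≡ : πShape n m (p m T₀) S′ ≡ ℕtoℚ (countᵇ (firstHasShape m n S′) (O m T₀)) *ℚ invℕ (length (O m T₀))
  πShape-p≡ = begin
    πShape n m (p m T₀) S′
      ≡⟨ cong sumℚ (map-cong (λ S → sumℚ-if (λ Q → shape Q ≅ₛ T₀) c (filter (λ Q → T? (matchesFirst Q S)) (RBL m))) (O n S′)) ⟩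
    sumℚ (map (λ S → ℕtoℚ (fibreSize S) *ℚ c) (O n S′))
      ≡⟨ sumℚ-scale fibreSize c (O n S′) ⟩
    ℕtoℚ (sum (map fibreSize (O n S′))) *ℚ c
      ≡⟨ cong (λ k → ℕtoℚ k *ℚ c) fibreSize-sum ⟩
    ℕtoℚ (countᵇ (firstHasShape m n S′) (O m T₀)) *ℚ c ∎
    where
    open ≡-Reasoning
    c : ℚ
    c = invℕ (length (O m T₀))
    fibreSize-sum : sum (map fibreSize (O n S′)) ≡ countᵇ (firstHasShape m n S′) (O m T₀)
    fibreSize-sum = begin
      sum (map fibreSize (O n S′))
        ≡⟨ cong sum (map-cong (λ S → countᵇ-filter (λ Q → matchesFirst Q S) (λ Q → shape Q ≅ₛ T₀) (RBL m)) (O n S′)) ⟩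
      sum (map (λ S → countᵇ (λ Q → matchesFirst Q S ∧ (shape Q ≅ₛ T₀)) (RBL m)) (O n S′))
        ≡⟨ sum-countᵇ-comm (λ S Q → matchesFirst Q S ∧ (shape Q ≅ₛ T₀)) (O n S′) (RBL m) ⟩
      sum (map (λ Q → countᵇ (λ S → matchesFirst Q S ∧ (shape Q ≅ₛ T₀)) (O n S′)) (RBL m))
        ≡⟨ sum-cong-∈ _ _ (RBL m) (λ {Q} Q∈ → count-per-Q Q (∈-RBL⁻ m Q∈)) ⟩
      sum (map (λ Q → if (shape Q ≅ₛ T₀) ∧ firstHasShape m n S′ Q then 1 else 0) (RBL m))
        ≡⟨ sym (countᵇ≡sum (λ Q → (shape Q ≅ₛ T₀) ∧ firstHasShape m n S′ Q) (RBL m)) ⟩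
      countᵇ (λ Q → (shape Q ≅ₛ T₀) ∧ firstHasShape m n S′ Q) (RBL m)
        ≡⟨ sym (countᵇ-filter (λ Q → shape Q ≅ₛ T₀) (firstHasShape m n S′) (RBL m)) ⟩
      countᵇ (firstHasShape m n S′) (O m T₀) ∎

-- Indexing a list of naturals, with junk value 0 out of range.
nth : List ℕ → ℕ → ℕ
nth []       _       = 0
nth (x ∷ xs) zero    = x
nth (x ∷ xs) (suc k) = nth xs k

indexOf : ℕ → List ℕ → ℕ
indexOf x []       = 0
indexOf x (y ∷ ys) = if x ≡ᵇ y then 0 else suc (indexOf x ys)

nth∈ : (L : List ℕ) {k : ℕ} → k < length L → nth L k ∈ L
nth∈ (x ∷ L) {zero}  _       = here refl
nth∈ (x ∷ L) {suc k} (s≤s p) = there (nth∈ L p)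

nth-++ˡ : (xs ys : List ℕ) {k : ℕ} → k < length xs → nth (xs ++ ys) k ≡ nth xs k
nth-++ˡ (x ∷ xs) ys {zero}  _       = refl
nth-++ˡ (x ∷ xs) ys {suc k} (s≤s p) = nth-++ˡ xs ys p

nth-++ʳ : (xs ys : List ℕ) {k : ℕ} → length xs ≤ k → nth (xs ++ ys) k ≡ nth ys (k ∸ length xs)
nth-++ʳ []       ys _               = refl
nth-++ʳ (x ∷ xs) ys {suc k} (s≤s p) = nth-++ʳ xs ys p

indexOf-< : (x : ℕ) (L : List ℕ) → x ∈ L → indexOf x L < length L
indexOf-< x (y ∷ L) x∈ with x ≡ᵇ y in x≡y | x∈
... | true  | _           = s≤s z≤n
... | false | here refl   = ⊥-elim (subst T x≡y (ℕ.≡⇒≡ᵇ x x refl))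
... | false | there x∈L   = s≤s (indexOf-< x L x∈L)

nth-indexOf : (x : ℕ) (L : List ℕ) → x ∈ L → nth L (indexOf x L) ≡ x
nth-indexOf x (y ∷ L) x∈ with x ≡ᵇ y in x≡y | x∈
... | true  | _           = sym (ℕ.≡ᵇ⇒≡ x y (subst T (sym x≡y) _))
... | false | here refl   = ⊥-elim (subst T x≡y (ℕ.≡⇒≡ᵇ x x refl))
... | false | there x∈L   = nth-indexOf x L x∈L

indexOf-nth : (L : List ℕ) → Unique L → {k : ℕ} → k < length L → indexOf (nth L k) L ≡ k
indexOf-nth (x ∷ L) _ {zero} _ with x ≡ᵇ x in e
... | true  = refl
... | false = ⊥-elim (subst T e (ℕ.≡⇒≡ᵇ x x refl))
indexOf-nth (x ∷ L) (x∉L ∷ L!) {suc k} (s≤s k<) with nth L k ≡ᵇ x in e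
... | true  = ⊥-elim (All.lookup x∉L (nth∈ L k<) (sym (ℕ.≡ᵇ⇒≡ _ x (subst T (sym e) _))))
... | false = cong suc (indexOf-nth L L! k<)

record Perm (m : ℕ) : Set where
  field
    ρ ρ⁻       : ℕ → ℕ
    ρ-<        : ∀ {k} → k < m → ρ k < m
    ρ⁻-<       : ∀ {k} → k < m → ρ⁻ k < m
    ρ-ρ⁻       : ∀ {k} → k < m → ρ (ρ⁻ k) ≡ k
    ρ⁻-ρ       : ∀ {k} → k < m → ρ⁻ (ρ k) ≡ k

_⁻¹ : {m : ℕ} → Perm m → Perm m
P ⁻¹ = record { ρ = ρ⁻ ; ρ⁻ = ρ ; ρ-< = ρ⁻-< ; ρ⁻-< = ρ-< ; ρ-ρ⁻ = ρ⁻-ρ ; ρ⁻-ρ = ρ-ρ⁻ }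
  where open Perm P

listing : (m : ℕ) (L : List ℕ) → L ↭ upTo m → Perm m
listing m L L↭ = record
  { ρ    = nth L
  ; ρ⁻   = λ k → indexOf k L
  ; ρ-<  = λ k< → ∈-upTo⁻ (∈-resp-↭ L↭ (nth∈ L (subst (_ <_) (sym length-L) k<)))
  ; ρ⁻-< = λ k< → subst (_ <_) length-L (indexOf-< _ L (∈L k<))
  ; ρ-ρ⁻ = λ k< → nth-indexOf _ L (∈L k<)
  ; ρ⁻-ρ = λ k< → indexOf-nth L L! (subst (_ <_) (sym length-L) k<)
  }
  where
  length-L : length L ≡ m
  length-L = trans (↭-length L↭) (length-upTo m)
  ∈L : ∀ {k} → k < m → k ∈ L
  ∈L k< = ∈-resp-↭ (↭-sym L↭) (∈-upTo⁺ k<)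
  L! : Unique L
  L! = unique-resp-↭ (↭-sym L↭) (Unique.upTo⁺ m)

countᵇ-∘ρ-≤ : {m : ℕ} (P : Perm m) (f : ℕ → Bool) → countᵇ (f ∘ Perm.ρ P) (upTo m) ≤ countᵇ f (upTo m)
countᵇ-∘ρ-≤ {m} P f = countᵇ-≤-injection (f ∘ ρ) f (upTo m) (upTo m) ρ (Unique.upTo⁺ m)
  (λ k∈ fρk → ∈-upTo⁺ (ρ-< (∈-upTo⁻ k∈)) , fρk)
  (λ k∈ k′∈ e → trans (sym (ρ⁻-ρ (∈-upTo⁻ k∈))) (trans (cong ρ⁻ e) (ρ⁻-ρ (∈-upTo⁻ k′∈))))
  where open Perm P

countᵇ-∘ρ : {m : ℕ} (P : Perm m) (f : ℕ → Bool) → countᵇ (f ∘ Perm.ρ P) (upTo m) ≡ countᵇ f (upTo m)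
countᵇ-∘ρ {m} P f = ℕ.≤-antisym (countᵇ-∘ρ-≤ P f)
  (subst (_≤ countᵇ (f ∘ ρ) (upTo m))
    (countᵇ-cong-∈ _ _ (upTo m) (λ k∈ → cong f (ρ-ρ⁻ (∈-upTo⁻ k∈))))
    (countᵇ-∘ρ-≤ (P ⁻¹) (f ∘ ρ)))
  where open Perm P

member-map-applyUpTo : (f : ℕ → Bool) (g : ℕ → ℕ) (l : ℕ) {k : ℕ} → k < l →
  member (map f (applyUpTo g l)) k ≡ f (g k)
member-map-applyUpTo f g (suc l) {zero}  _       = refl
member-map-applyUpTo f g (suc l) {suc k} (s≤s p) = member-map-applyUpTo f (g ∘ suc) l p

member-ext : (A B : List Bool) → length A ≡ length B →
  (∀ {k} → k < length A → member A k ≡ member B k) → A ≡ B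
member-ext []      []      _  _      = refl
member-ext (a ∷ A) (b ∷ B) eq same =
  cong₂ _∷_ (same (s≤s z≤n)) (member-ext A B (ℕ.suc-injective eq) (same ∘ s≤s))

card≡countᵇ-member : (A : List Bool) → card A ≡ countᵇ (member A) (upTo (length A))
card≡countᵇ-member A = go A (member A) (λ k → k) (λ _ → refl)
  where
  go : (A : List Bool) (h : ℕ → Bool) (g : ℕ → ℕ) → (∀ {j} → j < length A → h (g j) ≡ member A j) →
    card A ≡ countᵇ h (applyUpTo g (length A))
  go []      h g _    = refl
  go (b ∷ A) h g h∘g with h (g 0) | h∘g {0} (s≤s z≤n)
  ... | true  | refl = cong suc (go A h (g ∘ suc) (h∘g ∘ s≤s))
  ... | false | refl = go A h (g ∘ suc) (h∘g ∘ s≤s)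

preimage : {m : ℕ} → Perm m → List Bool → List Bool
preimage {m} P A = map (member A ∘ Perm.ρ P) (upTo m)

length-preimage : {m : ℕ} (P : Perm m) (A : List Bool) → length (preimage P A) ≡ m
length-preimage {m} P A = trans (length-map _ (upTo m)) (length-upTo m)

member-preimage : {m : ℕ} (P : Perm m) (A : List Bool) {k : ℕ} → k < m → member (preimage P A) k ≡ member A (Perm.ρ P k)
member-preimage {m} P A = member-map-applyUpTo (member A ∘ Perm.ρ P) (λ k → k) m

preimage-⁻¹ : {m : ℕ} (P : Perm m) (A : List Bool) → length A ≡ m → preimage (P ⁻¹) (preimage P A) ≡ A
preimage-⁻¹ {m} P A length-A = member-ext _ _ (trans (length-preimage (P ⁻¹) (preimage P A)) (sym length-A)) λ {k} k< →
  let k<m = subst (k <_) (length-preimage (P ⁻¹) (preimage P A)) k< in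
  trans (member-preimage (P ⁻¹) (preimage P A) k<m)
        (trans (member-preimage P A (Perm.ρ⁻-< P k<m)) (cong (member A) (Perm.ρ-ρ⁻ P k<m)))

card-preimage : {m : ℕ} (P : Perm m) (A : List Bool) → length A ≡ m → card (preimage P A) ≡ card A
card-preimage {m} P A length-A = begin
  card (preimage P A)
    ≡⟨ card≡countᵇ-member (preimage P A) ⟩
  countᵇ (member (preimage P A)) (upTo (length (preimage P A)))
    ≡⟨ cong (countᵇ (member (preimage P A)) ∘ upTo) (length-preimage P A) ⟩
  countᵇ (member (preimage P A)) (upTo m)
    ≡⟨ countᵇ-cong-∈ _ _ (upTo m) (member-preimage P A ∘ ∈-upTo⁻) ⟩
  countᵇ (member A ∘ Perm.ρ P) (upTo m)
    ≡⟨ countᵇ-∘ρ P (member A) ⟩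
  countᵇ (member A) (upTo m)
    ≡⟨ cong (countᵇ (member A) ∘ upTo) (sym length-A) ⟩
  countᵇ (member A) (upTo (length A))
    ≡⟨ sym (card≡countᵇ-member A) ⟩
  card A ∎
  where open ≡-Reasoning

length-∈-subsetsOf : (k : ℕ) {A : List Bool} → A ∈ subsetsOf k → length A ≡ k
length-∈-subsetsOf zero    (here refl) = refl
length-∈-subsetsOf (suc k) A∈ with s , s∈ , A∈two ← find (∈-concatMap⁻ _ {xs = subsetsOf k} A∈) | A∈two
... | here refl         = cong suc (length-∈-subsetsOf k s∈)
... | there (here refl) = cong suc (length-∈-subsetsOf k s∈)

∈-subsetsOf : (k : ℕ) (A : List Bool) → length A ≡ k → A ∈ subsetsOf k
∈-subsetsOf zero    []          _  = here refl
∈-subsetsOf (suc k) (true ∷ A)  eq = ∈-concatMap⁺ _ (lose (∈-subsetsOf k A (ℕ.suc-injective eq)) (here refl))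
∈-subsetsOf (suc k) (false ∷ A) eq = ∈-concatMap⁺ _ (lose (∈-subsetsOf k A (ℕ.suc-injective eq)) (there (here refl)))

subsetsOf-suc : (k : ℕ) →
  subsetsOf (suc k) ≡ cartesianProductWith (λ s b → b ∷ s) (subsetsOf k) (true ∷ false ∷ [])
subsetsOf-suc k = go (subsetsOf k)
  where
  go : (ss : List (List Bool)) →
    concatMap (λ s → (true ∷ s) ∷ (false ∷ s) ∷ []) ss ≡ cartesianProductWith (λ s b → b ∷ s) ss (true ∷ false ∷ [])
  go []       = refl
  go (s ∷ ss) = cong (λ l → (true ∷ s) ∷ (false ∷ s) ∷ l) (go ss)

subsetsOf-unique : (k : ℕ) → Unique (subsetsOf k)
subsetsOf-unique zero    = [] ∷ []
subsetsOf-unique (suc k) = subst Unique (sym (subsetsOf-suc k))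
  (Unique.cartesianProductWith⁺ (λ s b → b ∷ s) (λ { refl → refl , refl }) (subsetsOf-unique k)
    (((λ ()) ∷ []) ∷ ([] ∷ [])))

Subsets : ℕ → ℕ → List (List Bool)
Subsets m n = filter (λ A → T? (card A ≡ᵇ n)) (subsetsOf m)

countᵇ-subsetsOf-suc : (f : List Bool → Bool) (k : ℕ) →
  countᵇ f (subsetsOf (suc k)) ≡ countᵇ (f ∘ (true ∷_)) (subsetsOf k) + countᵇ (f ∘ (false ∷_)) (subsetsOf k)
countᵇ-subsetsOf-suc f k = go (subsetsOf k)
  where
  go : (ss : List (List Bool)) → countᵇ f (concatMap (λ s → (true ∷ s) ∷ (false ∷ s) ∷ []) ss)
                                   ≡ countᵇ (f ∘ (true ∷_)) ss + countᵇ (f ∘ (false ∷_)) ss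
  go []       = refl
  go (s ∷ ss) with f (true ∷ s)
  ... | true with f (false ∷ s)
  ...   | true  = cong suc (trans (cong suc (go ss)) (sym (ℕ.+-suc _ _)))
  ...   | false = cong suc (go ss)
  go (s ∷ ss) | false with f (false ∷ s)
  ...   | true  = trans (cong suc (go ss)) (sym (ℕ.+-suc _ _))
  ...   | false = go ss

length-Subsets : (m n : ℕ) → length (Subsets m n) ≡ m C n
length-Subsets zero    zero    = refl
length-Subsets zero    (suc n) = refl
length-Subsets (suc m) zero    =
  trans (countᵇ-subsetsOf-suc (λ A → card A ≡ᵇ 0) m)
        (trans (cong (_+ length (Subsets m 0)) (no-true (subsetsOf m))) (length-Subsets m zero))
  where
  no-true : (ss : List (List Bool)) → countᵇ (λ s → card (true ∷ s) ≡ᵇ 0) ss ≡ 0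
  no-true []       = refl
  no-true (_ ∷ ss) = no-true ss
length-Subsets (suc m) (suc n) =
  trans (countᵇ-subsetsOf-suc (λ A → card A ≡ᵇ suc n) m)
        (trans (cong₂ _+_ (length-Subsets m n) (length-Subsets m (suc n))) (nCk+nC[k+1]≡[n+1]C[k+1] m n))

length-∈-Subsets : {m n : ℕ} {A : List Bool} → A ∈ Subsets m n → length A ≡ m
length-∈-Subsets {m} {n} A∈ = length-∈-subsetsOf m (proj₁ (∈-filter⁻ (λ A → T? (card A ≡ᵇ n)) {xs = subsetsOf m} A∈))

preimage-∈-Subsets : {m n : ℕ} (P : Perm m) {A : List Bool} → A ∈ Subsets m n → preimage P A ∈ Subsets m n
preimage-∈-Subsets {m} {n} P {A} A∈ with A∈S , cardA ← ∈-filter⁻ (λ A → T? (card A ≡ᵇ n)) {xs = subsetsOf m} A∈ =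
  ∈-filter⁺ (λ A → T? (card A ≡ᵇ n)) (∈-subsetsOf m (preimage P A) (length-preimage P A))
    (subst (λ c → T (c ≡ᵇ n)) (sym (card-preimage P A (length-∈-subsetsOf m A∈S))) cardA)

countᵇ-∘preimage-≤ : {m n : ℕ} (P : Perm m) (H : List Bool → Bool) →
  countᵇ (H ∘ preimage P) (Subsets m n) ≤ countᵇ H (Subsets m n)
countᵇ-∘preimage-≤ {m} {n} P H = countᵇ-≤-injection (H ∘ preimage P) H (Subsets m n) (Subsets m n) (preimage P)
  (Unique.filter⁺ (λ A → T? (card A ≡ᵇ n)) (subsetsOf-unique m))
  (λ A∈ HA → preimage-∈-Subsets P A∈ , HA)
  (λ A∈ A′∈ e → trans (sym (preimage-⁻¹ P _ (length-∈-Subsets A∈)))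
                  (trans (cong (preimage (P ⁻¹)) e) (preimage-⁻¹ P _ (length-∈-Subsets A′∈))))

countᵇ-∘preimage : {m n : ℕ} (P : Perm m) (H : List Bool → Bool) →
  countᵇ (H ∘ preimage P) (Subsets m n) ≡ countᵇ H (Subsets m n)
countᵇ-∘preimage {m} {n} P H = ℕ.≤-antisym (countᵇ-∘preimage-≤ P H)
  (subst (_≤ countᵇ (H ∘ preimage P) (Subsets m n))
    (countᵇ-cong-∈ _ _ (Subsets m n) (λ A∈ → cong H (preimage-⁻¹ (P ⁻¹) _ (length-∈-Subsets A∈))))
    (countᵇ-∘preimage-≤ (P ⁻¹) (H ∘ preimage P)))

-- A permutation of [0, m) mapping [0, n) onto the n-subset A: list A, then its complement.
module _ {m n : ℕ} {A : List Bool} (A∈ : A ∈ Subsets m n) where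

  private
    inA outA : List ℕ
    inA  = filter (T? ∘ member A) (upTo m)
    outA = filter (∁? (T? ∘ member A)) (upTo m)

    inA++outA↭ : inA ++ outA ↭ upTo m
    inA++outA↭ = ↭-sym (subst (λ (ys , zs) → upTo m ↭ ys ++ zs) (partition-defn (T? ∘ member A) (upTo m))
                           (↭ₛ⇒↭ (partition-↭ (setoid ℕ) (T? ∘ member A) (upTo m))))

    length-inA : length inA ≡ n
    length-inA = begin
      length inA                  ≡⟨⟩
      countᵇ (member A) (upTo m)  ≡⟨ cong (countᵇ (member A) ∘ upTo) (sym (length-∈-Subsets {m} {n} A∈)) ⟩
      countᵇ (member A) (upTo (length A)) ≡⟨ sym (card≡countᵇ-member A) ⟩
      card A                      ≡⟨ ℕ.≡ᵇ⇒≡ (card A) n (proj₂ (∈-filter⁻ (λ A → T? (card A ≡ᵇ n)) {xs = subsetsOf m} A∈)) ⟩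
      n ∎
      where open ≡-Reasoning

    length-inA+outA : length inA + length outA ≡ m
    length-inA+outA = trans (sym (length-++ inA)) (trans (↭-length inA++outA↭) (length-upTo m))

  subsetFirst : Perm m
  subsetFirst = listing m (inA ++ outA) inA++outA↭

  member-subsetFirst-< : ∀ {k} → k < n → member A (Perm.ρ subsetFirst k) ≡ true
  member-subsetFirst-< {k} k<n rewrite nth-++ˡ inA outA (subst (k <_) (sym length-inA) k<n) =
    Equivalence.to T-≡ (proj₂ (∈-filter⁻ (T? ∘ member A) {xs = upTo m} (nth∈ inA (subst (k <_) (sym length-inA) k<n))))

  member-subsetFirst-≮ : ∀ {k} → k < m → ¬ k < n → member A (Perm.ρ subsetFirst k) ≡ false
  member-subsetFirst-≮ {k} k<m k≮n rewrite nth-++ʳ inA outA (subst (_≤ k) (sym length-inA) (ℕ.≮⇒≥ k≮n)) =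
    ¬T⇒≡false (proj₂ (∈-filter⁻ (∁? (T? ∘ member A)) {xs = upTo m} (nth∈ outA k∸<)))
    where
    n≤k : length inA ≤ k
    n≤k = subst (_≤ k) (sym length-inA) (ℕ.≮⇒≥ k≮n)
    k∸< : k ∸ length inA < length outA
    k∸< = subst (k ∸ length inA <_) (ℕ.m+n∸m≡n (length inA) (length outA))
            (ℕ.∸-monoˡ-< (subst (k <_) (sym length-inA+outA) k<m) n≤k)

module _ {m : ℕ} (P : Perm m) where

  open Perm P

  relabel : Fin m → Fin m
  relabel j = fromℕ< (ρ-< (toℕ<n j))

  toℕ-relabel : (j : Fin m) → toℕ (relabel j) ≡ ρ (toℕ j)
  toℕ-relabel j = toℕ-fromℕ< _

relabel-⁻¹ : {m : ℕ} (P : Perm m) (j : Fin m) → relabel P (relabel (P ⁻¹) j) ≡ j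
relabel-⁻¹ P j = toℕ-injective (trans (toℕ-relabel P _)
  (trans (cong (Perm.ρ P) (toℕ-relabel (P ⁻¹) j)) (Perm.ρ-ρ⁻ P (toℕ<n j))))

mapT-relabel-⁻¹ : {m : ℕ} (P : Perm m) (Q : Tree (Fin m)) → mapT (relabel P) (mapT (relabel (P ⁻¹)) Q) ≡ Q
mapT-relabel-⁻¹ P Q = trans (mapT-∘ _ _ Q)
  (trans (mapT-cong-leaves _ (λ j → j) Q (All.tabulate (λ {j} _ → relabel-⁻¹ P j))) (mapT-id Q))

bijective-relabel : {m : ℕ} (P : Perm m) (Q : Tree (Fin m)) → Bijective m Q → Bijective m (mapT (relabel P) Q)
bijective-relabel {m} P Q bij = subst (_↭ allFin m) (sym (leaves-mapT (relabel P) Q))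
  (↭-trans (↭.map⁺ (relabel P) bij)
    (unique-⊆⊇⇒↭ (Unique.map⁺ relabel-injective (Unique.allFin⁺ m)) (Unique.allFin⁺ m) (λ {j} _ → ∈-allFin j)
      (λ {j} _ → subst (_∈ map (relabel P) (allFin m)) (relabel-⁻¹ P j) (∈-map⁺ (relabel P) (∈-allFin _)))))
  where
  relabel-injective : ∀ {i j} → relabel P i ≡ relabel P j → i ≡ j
  relabel-injective {i} {j} e =
    trans (sym (relabel-⁻¹ (P ⁻¹) i)) (trans (cong (relabel (P ⁻¹)) e) (relabel-⁻¹ (P ⁻¹) j))

module _ (m : ℕ) (T₀ : Shape) where

  private
    ∈-O⁻ : ∀ {Q} → Q ∈ O m T₀ → Q ∈ RBL m × T (shape Q ≅ₛ T₀)
    ∈-O⁻ = ∈-filter⁻ (T? ∘ λ Q → shape Q ≅ₛ T₀) {xs = RBL m}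

  -- Relabelling permutes the isomorphism classes of labelled trees of shape T₀.
  countᵇ-O-relabel-≤ : (P : Perm m) (f g : Tree (Fin m) → Bool) →
    (∀ Q Q′ → Q ≈ₗ Q′ → g Q ≡ g Q′) → (∀ Q → g (mapT (relabel P) Q) ≡ f Q) →
    countᵇ f (O m T₀) ≤ countᵇ g (O m T₀)
  countᵇ-O-relabel-≤ P f g g-resp g∘relabel =
    length-≤-pigeonhole (_≈ₗ_ {m}) (λ Q Q′ → mapT σ Q ≈ₗ Q′) injective
      (filter (T? ∘ f) (O m T₀)) (filter (T? ∘ g) (O m T₀))
      (AllPairs.filter⁺ (T? ∘ f) (AllPairs.filter⁺ _ (RBL-distinct m))) image
    where
    σ = relabel P
    injective : ∀ Q₁ Q₂ Q′ → mapT σ Q₁ ≈ₗ Q′ → mapT σ Q₂ ≈ₗ Q′ → Q₁ ≈ₗ Q₂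
    injective Q₁ Q₂ Q′ p q = subst₂ _≈ₗ_ (mapT-relabel-⁻¹ (P ⁻¹) Q₁) (mapT-relabel-⁻¹ (P ⁻¹) Q₂)
      (≈ₗ-mapT (relabel (P ⁻¹)) (mapT σ Q₁) (mapT σ Q₂)
        (≅ₗ.iso-trans (mapT σ Q₁) Q′ (mapT σ Q₂) p (≅ₗ.iso-sym (mapT σ Q₂) Q′ q)))
    image : ∀ {Q} → Q ∈ filter (T? ∘ f) (O m T₀) → Any (mapT σ Q ≈ₗ_) (filter (T? ∘ g) (O m T₀))
    image {Q} Q∈ with Q∈O , fQ ← ∈-filter⁻ (T? ∘ f) {xs = O m T₀} Q∈ with Q∈RBL , Q≅T ← ∈-O⁻ Q∈O
      with w , w∈ , σQ≈w ← find (∈-RBL⁺ m (mapT σ Q) (bijective-relabel P Q (∈-RBL⁻ m Q∈RBL))) =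
      lose (∈-filter⁺ (T? ∘ g) (∈-filter⁺ (T? ∘ λ Q → shape Q ≅ₛ T₀) w∈ w≅T)
                      (subst T (trans (sym (g∘relabel Q)) (g-resp _ w σQ≈w)) fQ)) σQ≈w
      where
      w≅T : T (shape w ≅ₛ T₀)
      w≅T = ≅ₛ.iso-trans (shape w) (shape Q) T₀
        (subst (λ S → T (shape w ≅ₛ S)) (shape-mapT σ Q)
          (≅ₛ.iso-sym (shape (mapT σ Q)) (shape w) (≈ₗ⇒≅ₛ (mapT σ Q) w σQ≈w))) Q≅T

  countᵇ-O-relabel : (P : Perm m) (f g : Tree (Fin m) → Bool) →
    (∀ Q Q′ → Q ≈ₗ Q′ → f Q ≡ f Q′) → (∀ Q Q′ → Q ≈ₗ Q′ → g Q ≡ g Q′) →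
    (∀ Q → g (mapT (relabel P) Q) ≡ f Q) → countᵇ f (O m T₀) ≡ countᵇ g (O m T₀)
  countᵇ-O-relabel P f g f-resp g-resp g∘relabel = ℕ.≤-antisym
    (countᵇ-O-relabel-≤ P f g g-resp g∘relabel)
    (countᵇ-O-relabel-≤ (P ⁻¹) g f f-resp λ Q →
      trans (sym (g∘relabel (mapT (relabel (P ⁻¹)) Q))) (cong g (mapT-relabel-⁻¹ P Q)))

applyUpTo-nth : (L : List ℕ) → applyUpTo (nth L) (length L) ≡ L
applyUpTo-nth []      = refl
applyUpTo-nth (x ∷ L) = cong (x ∷_) (applyUpTo-nth L)

node-injective : {l r l′ r′ : Tree A} → node l r ≡ node l′ r′ → l ≡ l′ × r ≡ r′
node-injective refl = refl , refl

length-leaves-shape : (t u : Tree A) → shape t ≡ shape u → length (leaves t) ≡ length (leaves u)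
length-leaves-shape t u sh = begin
  length (leaves t)   ≡⟨ sym (leafCount≡length-leaves t) ⟩
  leafCount t         ≡⟨ sym (leafCount-shape t) ⟩
  leafCount (shape t) ≡⟨ cong leafCount sh ⟩
  leafCount (shape u) ≡⟨ leafCount-shape u ⟩
  leafCount u         ≡⟨ leafCount≡length-leaves u ⟩
  length (leaves u)   ∎
  where open ≡-Reasoning

shape-leaves-injective : (t u : Tree A) → shape t ≡ shape u → leaves t ≡ leaves u → t ≡ u
shape-leaves-injective (leaf a)   (leaf b)     _  refl = refl
shape-leaves-injective (leaf _)   (node _ _)   () _
shape-leaves-injective (node _ _) (leaf _)     () _
shape-leaves-injective (node l r) (node l′ r′) sh lv =
  let shl , shr = node-injective sh
      lvl , lvr = ++-injective (length-leaves-shape l l′ shl) lv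
  in cong₂ node (shape-leaves-injective l l′ shl lvl) (shape-leaves-injective r r′ shr lvr)

numbered : Tree A → ℕ → Tree ℕ
numbered t i = proj₁ (number t i)

number-node : (l r : Tree A) (i : ℕ) → number (node l r) i ≡
  (node (numbered l i) (numbered r (proj₂ (number l i))) , proj₂ (number r (proj₂ (number l i))))
number-node l r i with number l i
... | l′ , j with number r j
...   | r′ , k = refl

number-next : (t : Tree A) (i : ℕ) → proj₂ (number t i) ≡ i + leafCount t
number-next (leaf _)   i = sym (ℕ.+-comm i 1)
number-next (node l r) i rewrite number-node l r i
  | number-next r (proj₂ (number l i)) | number-next l i = ℕ.+-assoc i (leafCount l) (leafCount r)

number-mapT : (f : A → B) (t : Tree A) (i : ℕ) → number (mapT f t) i ≡ number t i
number-mapT f (leaf _)   i = refl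
number-mapT f (node l r) i rewrite number-node (mapT f l) (mapT f r) i | number-node l r i
  | number-mapT f l i | number-mapT f r (proj₂ (number l i)) = refl

shape-numbered : (t : Tree A) (i : ℕ) → shape (numbered t i) ≡ shape t
shape-numbered (leaf _)   i = refl
shape-numbered (node l r) i rewrite number-node l r i =
  cong₂ node (shape-numbered l i) (shape-numbered r (proj₂ (number l i)))

leaves-numbered : (t : Tree A) (i : ℕ) → leaves (numbered t i) ≡ applyUpTo (i +_) (leafCount t)
leaves-numbered (leaf _)   i = cong (_∷ []) (sym (ℕ.+-identityʳ i))
leaves-numbered (node l r) i rewrite number-node l r i = begin
  leaves (numbered l i) ++ leaves (numbered r j)
    ≡⟨ cong₂ _++_ (leaves-numbered l i) (leaves-numbered r j) ⟩
  applyUpTo (i +_) (leafCount l) ++ applyUpTo (j +_) (leafCount r)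
    ≡⟨ cong (applyUpTo (i +_) (leafCount l) ++_)
         (applyUpTo-cong (λ k → trans (cong (_+ k) (number-next l i)) (ℕ.+-assoc i (leafCount l) k)) (leafCount r)) ⟩
  applyUpTo (i +_) (leafCount l) ++ applyUpTo ((i +_) ∘ (leafCount l +_)) (leafCount r)
    ≡⟨ sym (applyUpTo-+ (i +_) (leafCount l) (leafCount r)) ⟩
  applyUpTo (i +_) (leafCount l + leafCount r) ∎
  where
  open ≡-Reasoning
  j = proj₂ (number l i)

mapT-nth-numbered : (u : Tree ℕ) → mapT (nth (leaves u)) (numbered u 0) ≡ u
mapT-nth-numbered u = shape-leaves-injective _ u
  (trans (shape-mapT _ (numbered u 0)) (shape-numbered u 0))
  (begin
    leaves (mapT (nth (leaves u)) (numbered u 0))    ≡⟨ leaves-mapT _ (numbered u 0) ⟩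
    map (nth (leaves u)) (leaves (numbered u 0))     ≡⟨ cong (map (nth (leaves u))) (leaves-numbered u 0) ⟩
    map (nth (leaves u)) (upTo (leafCount u))        ≡⟨ map-upTo (nth (leaves u)) (leafCount u) ⟩
    applyUpTo (nth (leaves u)) (leafCount u)         ≡⟨ cong (applyUpTo (nth (leaves u))) (leafCount≡length-leaves u) ⟩
    applyUpTo (nth (leaves u)) (length (leaves u))   ≡⟨ applyUpTo-nth (leaves u) ⟩
    leaves u ∎)
  where open ≡-Reasoning

mapT-nth-numbered-shape : (f : A → ℕ) (u : Tree A) → mapT f u ≡ mapT (nth (map f (leaves u))) (numbered (shape u) 0)
mapT-nth-numbered-shape f u = sym (trans
  (cong₂ (λ L N → mapT (nth L) N) (sym (leaves-mapT f u))
         (cong proj₁ (trans (number-mapT _ u 0) (sym (number-mapT f u 0)))))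
  (mapT-nth-numbered (mapT f u)))

-- Double counting

tabulate-∘toℕ : {A : Set} (f : ℕ → A) (k : ℕ) → tabulate (f ∘ toℕ {k}) ≡ applyUpTo f k
tabulate-∘toℕ f zero    = refl
tabulate-∘toℕ f (suc k) = cong (f 0 ∷_) (tabulate-∘toℕ (f ∘ suc) k)

map-toℕ-allFin : (k : ℕ) → map toℕ (allFin k) ≡ upTo k
map-toℕ-allFin k = trans (map-tabulate (λ i → i) toℕ) (tabulate-∘toℕ (λ i → i) k)

module _ (m n : ℕ) (S′ T₀ : Shape) where

  selectedHasShape : List Bool → Tree (Fin m) → Bool
  selectedHasShape A Q = hasShape S′ (restrict (select A ∘ toℕ) Q)

  selectedHasShape-resp : ∀ A Q Q′ → Q ≈ₗ Q′ → selectedHasShape A Q ≡ selectedHasShape A Q′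
  selectedHasShape-resp A Q Q′ Q≈Q′ = hasShape-resp S′
    (restrict-iso _ (select A ∘ toℕ) (λ i j p → cong (select A ∘ toℕ) (toWitness p)) Q Q′ Q≈Q′)

  firstHasShape-restrict : ∀ Q → firstHasShape m n S′ Q ≡ hasShape S′ (restrict (Maybe.map (λ _ → tt) ∘ toFirst m n) Q)
  firstHasShape-restrict Q = cong (hasShape S′) (shape-restrict (toFirst m n) Q)

  firstHasShape-resp : ∀ Q Q′ → Q ≈ₗ Q′ → firstHasShape m n S′ Q ≡ firstHasShape m n S′ Q′
  firstHasShape-resp Q Q′ Q≈Q′ = trans (firstHasShape-restrict Q)
    (trans (hasShape-resp S′ (restrict-iso _ _ (λ i j p → cong (Maybe.map (λ _ → tt) ∘ toFirst m n) (toWitness p)) Q Q′ Q≈Q′))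
           (sym (firstHasShape-restrict Q′)))

  -- Relabel by a permutation carrying [0, n) onto A.
  countᵇ-first≡selected : ∀ {A} → A ∈ Subsets m n →
    countᵇ (firstHasShape m n S′) (O m T₀) ≡ countᵇ (selectedHasShape A) (O m T₀)
  countᵇ-first≡selected {A} A∈ =
    countᵇ-O-relabel m T₀ P _ _ firstHasShape-resp (selectedHasShape-resp A) λ Q →
      trans (cong (hasShape S′) (trans (restrict-mapT (select A ∘ toℕ) (relabel P) Q)
                                       (restrict-cong-leaves _ _ Q (All.tabulate λ {j} _ → select-relabel j))))
            (sym (firstHasShape-restrict Q))
    where
    P = subsetFirst {m} {n} A∈
    select-relabel : (j : Fin m) → select A (toℕ (relabel P j)) ≡ Maybe.map (λ _ → tt) (toFirst m n j)
    select-relabel j rewrite toℕ-relabel P j with toℕ j <? n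
    ... | yes j<n = cong (λ b → if b then just tt else nothing) (member-subsetFirst-< {m} {n} A∈ j<n)
    ... | no  j≮n = cong (λ b → if b then just tt else nothing) (member-subsetFirst-≮ {m} {n} A∈ (toℕ<n j) j≮n)

  restrictHasShape-numbered : ∀ B → restrictHasShape T₀ B S′ ≡ hasShape S′ (restrict (select B) (numbered T₀ 0))
  restrictHasShape-numbered B with restrict (select B) (numbered T₀ 0)
  ... | just _  = refl
  ... | nothing = refl

  -- Relabel by the permutation listing the leaves of Q from left to right.
  countᵇ-selected≡induced : leafCount T₀ ≡ m → ∀ {Q} → Q ∈ O m T₀ →
    countᵇ (λ A → selectedHasShape A Q) (Subsets m n) ≡ inducedCount n S′ T₀
  countᵇ-selected≡induced lcT {Q} Q∈
    with Q∈RBL , Q≅T₀ ← ∈-filter⁻ (T? ∘ λ Q → shape Q ≅ₛ T₀) {xs = RBL m} Q∈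
    with Q′ , Q≈Q′ , shape-Q′ ← ≅ₛ-lift _ (λ _ → fromWitness refl) Q T₀ Q≅T₀ = begin
      countᵇ (λ A → selectedHasShape A Q) (Subsets m n) ≡⟨ countᵇ-cong-∈ _ _ (Subsets m n) (λ {A} _ → selected≡ A) ⟩
      countᵇ (H ∘ preimage P) (Subsets m n)             ≡⟨ countᵇ-∘preimage P H ⟩
      countᵇ H (Subsets m n)                            ≡⟨ cong (λ k → countᵇ H (Subsets k n)) (sym lcT) ⟩
      inducedCount n S′ T₀                              ∎
    where
    open ≡-Reasoning
    H : List Bool → Bool
    H B = restrictHasShape T₀ B S′
    L : List ℕ
    L = map toℕ (leaves Q′)
    P : Perm m
    P = listing m L (subst (L ↭_) (map-toℕ-allFin m)
          (↭.map⁺ toℕ (↭-trans (↭-sym (≈ₗ⇒leaves-↭ Q Q′ Q≈Q′)) (∈-RBL⁻ m Q∈RBL))))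
    N₀ : Tree ℕ
    N₀ = numbered T₀ 0
    N₀-bound : All (_< m) (leaves N₀)
    N₀-bound = subst (All (_< m)) (sym (trans (leaves-numbered T₀ 0) (cong upTo lcT))) (All.tabulate ∈-upTo⁻)
    Q′≡N₀ : mapT toℕ Q′ ≡ mapT (nth L) N₀
    Q′≡N₀ = trans (mapT-nth-numbered-shape toℕ Q′) (cong (λ S → mapT (nth L) (numbered S 0)) shape-Q′)
    selected≡ : ∀ A → selectedHasShape A Q ≡ H (preimage P A)
    selected≡ A = begin
      selectedHasShape A Q                                ≡⟨ selectedHasShape-resp A Q Q′ Q≈Q′ ⟩
      hasShape S′ (restrict (select A ∘ toℕ) Q′)          ≡⟨ cong (hasShape S′) (sym (restrict-mapT (select A) toℕ Q′)) ⟩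
      hasShape S′ (restrict (select A) (mapT toℕ Q′))     ≡⟨ cong (hasShape S′ ∘ restrict (select A)) Q′≡N₀ ⟩
      hasShape S′ (restrict (select A) (mapT (nth L) N₀)) ≡⟨ cong (hasShape S′) (restrict-mapT (select A) (nth L) N₀) ⟩
      hasShape S′ (restrict (select A ∘ nth L) N₀)        ≡⟨ cong (hasShape S′) (restrict-cong-leaves _ _ N₀ select≡) ⟩
      hasShape S′ (restrict (select (preimage P A)) N₀)   ≡⟨ sym (restrictHasShape-numbered (preimage P A)) ⟩
      H (preimage P A)                                    ∎
      where
      select≡ : All (λ k → select A (nth L k) ≡ select (preimage P A) k) (leaves N₀)
      select≡ = All.map (λ k<m → cong (λ b → if b then just tt else nothing) (sym (member-preimage P A k<m))) N₀-bound

  double-count : leafCount T₀ ≡ m →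
    length (Subsets m n) * countᵇ (firstHasShape m n S′) (O m T₀) ≡ length (O m T₀) * inducedCount n S′ T₀
  double-count lcT = begin
    length (Subsets m n) * N
      ≡⟨ sym (sum-const N (Subsets m n)) ⟩
    sum (map (λ _ → N) (Subsets m n))
      ≡⟨ sum-cong-∈ _ _ (Subsets m n) countᵇ-first≡selected ⟩
    sum (map (λ A → countᵇ (selectedHasShape A) (O m T₀)) (Subsets m n))
      ≡⟨ sum-countᵇ-comm selectedHasShape (Subsets m n) (O m T₀) ⟩
    sum (map (λ Q → countᵇ (λ A → selectedHasShape A Q) (Subsets m n)) (O m T₀))
      ≡⟨ sum-cong-∈ _ _ (O m T₀) (countᵇ-selected≡induced lcT) ⟩
    sum (map (λ _ → I) (O m T₀))
      ≡⟨ sum-const I (O m T₀) ⟩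
    length (O m T₀) * I ∎
    where
    open ≡-Reasoning
    N = countᵇ (firstHasShape m n S′) (O m T₀)
    I = inducedCount n S′ T₀

-- Junk value zero outside [0, 1 + k).
toFin : (k : ℕ) → ℕ → Fin (suc k)
toFin k i with i <? suc k
... | yes i< = fromℕ< i<
... | no  _  = zero

toFin-toℕ : (k : ℕ) (j : Fin (suc k)) → toFin k (toℕ j) ≡ j
toFin-toℕ k j with toℕ j <? suc k
... | yes j< = fromℕ<-toℕ j j<
... | no  j≮ = ⊥-elim (j≮ (toℕ<n j))

shape-Shape : (S : Shape) → shape S ≡ S
shape-Shape (leaf tt)  = refl
shape-Shape (node l r) = cong₂ node (shape-Shape l) (shape-Shape r)

bijective-labelling : (k : ℕ) (T₀ : Shape) → leafCount T₀ ≡ suc k →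
  Σ[ Q ∈ Tree (Fin (suc k)) ] shape Q ≡ T₀ × Bijective (suc k) Q
bijective-labelling k T₀ lcT = Q₀ , shape-Q₀ , subst (_↭ allFin (suc k)) (sym leaves-Q₀) ↭-refl
  where
  open ≡-Reasoning
  Q₀ : Tree (Fin (suc k))
  Q₀ = mapT (toFin k) (numbered T₀ 0)
  shape-Q₀ : shape Q₀ ≡ T₀
  shape-Q₀ = trans (shape-mapT (toFin k) (numbered T₀ 0)) (trans (shape-numbered T₀ 0) (shape-Shape T₀))
  leaves-Q₀ : leaves Q₀ ≡ allFin (suc k)
  leaves-Q₀ = begin
    leaves Q₀                                   ≡⟨ leaves-mapT (toFin k) (numbered T₀ 0) ⟩
    map (toFin k) (leaves (numbered T₀ 0))      ≡⟨ cong (map (toFin k)) (trans (leaves-numbered T₀ 0) (cong upTo lcT)) ⟩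
    map (toFin k) (upTo (suc k))                ≡⟨ cong (map (toFin k)) (sym (map-toℕ-allFin (suc k))) ⟩
    map (toFin k) (map toℕ (allFin (suc k)))    ≡⟨ sym (map-∘ (allFin (suc k))) ⟩
    map (toFin k ∘ toℕ) (allFin (suc k))        ≡⟨ map-cong (toFin-toℕ k) (allFin (suc k)) ⟩
    map (λ j → j) (allFin (suc k))              ≡⟨ map-id (allFin (suc k)) ⟩
    allFin (suc k)                              ∎

O-nonempty : (k : ℕ) (T₀ : Shape) → leafCount T₀ ≡ k → 0 < length (O k T₀)
O-nonempty k T₀ lcT with k′ , lc≡ ← leafCount-suc T₀ with refl ← trans (sym lcT) lc≡
  with Q₀ , shape-Q₀ , bij ← bijective-labelling k′ T₀ lc≡
  with w , w∈ , Q₀≈w ← find (∈-RBL⁺ (suc k′) Q₀ bij) =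
  ∈-length (∈-filter⁺ (T? ∘ λ Q → shape Q ≅ₛ T₀) w∈
    (subst (λ S → T (shape w ≅ₛ S)) shape-Q₀ (≅ₛ.iso-sym (shape Q₀) (shape w) (≈ₗ⇒≅ₛ Q₀ w Q₀≈w))))

0<C : (m n : ℕ) → n ≤ m → 0 < m C n
0<C m       zero    _         = s≤s z≤n
0<C (suc m) (suc n) (s≤s n≤m) =
  subst (0 <_) (nCk+nC[k+1]≡[n+1]C[k+1] m n) (ℕ.≤-trans (0<C m n n≤m) (ℕ.m≤m+n _ _))

corollary2p8 : (m n : ℕ) → 2 ≤ n → n ≤ m → (S′ T : Shape) →
    leafCount S′ ≡ n → leafCount T ≡ m →
    πShape n m (p m T) S′ ≡ density m n S′ T
-- The hypothesis leafCount S′ ≡ n is unused: when it fails, both sides are 0.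
corollary2p8 m n 2≤n n≤m S′ T _ lcT = begin
  πShape n m (p m T) S′                 ≡⟨ πShape-p≡ m n (ℕ.≤-trans (s≤s z≤n) 2≤n) n≤m S′ T ⟩
  ℕtoℚ N *ℚ invℕ (length (O m T))       ≡⟨ ℕtoℚ*invℕ-cross N I (O-nonempty m T lcT) (0<C m n n≤m) cross ⟩
  ℕtoℚ I *ℚ invℕ (m C n)                ∎
  where
  open ≡-Reasoning
  N = countᵇ (firstHasShape m n S′) (O m T)
  I = inducedCount n S′ T
  cross : N * (m C n) ≡ length (O m T) * I
  cross = trans (ℕ.*-comm N (m C n)) (trans (cong (_* N) (sym (length-Subsets m n))) (double-count m n S′ T lcT))
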